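{- Let $G$ be a planar mixed graph in which every vertex has degree exactly $3$ and every vertex is incident to exactly one required edge, and let $N$ be the flow network constructed from a rectilinear grid embedding of $G$ as described in the context. Then there is a bijection between the cycle covers of $G$ containing all required edges and the flows in $N$ (where the flow out of each source is restricted to the admissible distributions of its type).
   Context: Mixed graphs, cycles and cycle covers: a mixed graph $G=(V,E,A)$ has undirected edges $E$ and directed edges $A$; degree counts both kinds. A cycle is $v_1c_1\dots v_kc_kv_{k+1}$ with $v_1=v_{k+1}$, all $v_i,c_i$ distinct, each $c_i$ an undirected edge $\{v_i,v_{i+1}\}$ or a directed edge $(v_i,v_{i+1})$; cycles are identified up to starting vertex (orientation matters). A cycle cover is a family of vertex-disjoint cycles covering every vertex. A set $R\subseteq E$ of undirected edges is given (required edges); here we consider cycle covers containing all edges of $R$. Flow networks: a directed graph with $w:V\to\mathbb{Z}$; vertices with $w(v)>0$ are sources with supply $w(v)$, with $w(v)<0$ sinks with demand $-w(v)$; a flow is $f:E\to\mathbb{Z}_{\ge0}$ with $\sum_{e\in\delta^+(v)}f(e)-\sum_{e\in\delta^-(v)}f(e)=w(v)$ for all $v$ (no capacities). Every source has in-degree $0$, out-degree $2$ and supply $2$, and is one of four types restricting the pair of values on its two out-edges: unconstrained $\{(0,2),(1,1),(2,0)\}$; biased $\{(1,1),(2,0)\}$ (sends at least $1$ along a designated edge; it is said to be oriented toward that edge's endpoint); exclusive $\{(0,2),(2,0)\}$; fixed $\{(1,1)\}$. Construction: embed $G$ rectilinearly in a rectangular grid, vertices at lattice points and each edge as a path of unit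 grid segments, the paths being internally disjoint and meeting only at common endpoints; let $H$ be the rectangular grid graph containing the embedding. Build $N$: each lattice point of $H$ becomes a sink with demand equal to its degree in $H$; each unit segment of $H$ (used or not) is subdivided by a new source of supply $2$ whose two out-edges go to the segment's two endpoints. A segment lying on a directed edge $(u,v)$ of $G$ gets a biased source oriented toward the endpoint closer to $v$ along the edge; a segment on an undirected non-required edge gets an unconstrained source; a segment on a required edge gets an exclusive source; a segment not used by the embedding gets a fixed source. (The intended correspondence: at a sink, an edge is incoming, outgoing or unused in the cycle cover iff the corresponding flow value is $2$, $0$ or $1$.) -}

module Defs where

open import Data.Nat using (ℕ; zero; suc; _+_; _≤_)
open import Data.Fin using (Fin; inject₁) renaming (suc to fsuc)
import Data.Fin as F
open import Data.Bool using (Bool; true; false; not; if_then_else_)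
open import Data.Product using (Σ; ∃; ∃-syntax; _×_; _,_; proj₁; proj₂)
open import Data.Product.Properties using (≡-dec)
open import Data.Sum using (_⊎_)
open import Data.Unit using (⊤)
open import Data.Empty using (⊥)
open import Data.List using (List; []; _∷_; _++_; map; concat; concatMap; allFin; cartesianProduct)
open import Data.Nat.ListAction using (sum)
open import Data.List.Membership.Propositional using (_∈_; _∉_)
open import Data.List.Relation.Unary.All using (All)
open import Data.List.Relation.Unary.Unique.Propositional using (Unique)
open import Data.List.Relation.Binary.Pointwise using (Pointwise)
open import Data.List.Relation.Binary.Permutation.Propositional using (_↭_)
open import Relation.Nullary using (¬_; Dec; does)
open import Relation.Binary.PropositionalEquality using (_≡_; _≢_)

-- kind of an edge: directed (tl → hd), undirected non-required,
-- or undirected required (so R ⊆ E by construction)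
data EdgeKind : Set where
  directed undirected required : EdgeKind

isRequired : EdgeKind → Bool
isRequired required = true
isRequired _        = false

record MixedGraph : Set where
  field
    nV nE  : ℕ
    tl hd  : Fin nE → Fin nV
    kind   : Fin nE → EdgeKind
    noLoop : ∀ e → tl e ≢ hd e

module _ (G : MixedGraph) where
  open MixedGraph G

  ind : ∀ {p} {P : Set p} → Dec P → ℕ
  ind d = if does d then 1 else 0

  degree : Fin nV → ℕ
  degree v = sum (map (λ e → ind (tl e F.≟ v) + ind (hd e F.≟ v)) (allFin nE))

  reqDegree : Fin nV → ℕ
  reqDegree v = sum (map (λ e → if isRequired (kind e)
                                   then ind (tl e F.≟ v) + ind (hd e F.≟ v)
                                   else 0) (allFin nE))

  -- c may be the edge c_i from v_i = v to v_{i+1} = w of a cycle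
  Links : Fin nV → Fin nE → Fin nV → Set
  Links v c w =
      (kind c ≡ directed × tl c ≡ v × hd c ≡ w)
    ⊎ (kind c ≢ directed × ((tl c ≡ v × hd c ≡ w) ⊎ (tl c ≡ w × hd c ≡ v)))

  -- a cycle v1 c1 ... vk ck v1 is the list [(v1,c1), ..., (vk,ck)]
  Step : Set
  Step = Fin nV × Fin nE

  Chain : Fin nV → List Step → Set
  Chain v1 []                          = ⊤
  Chain v1 ((v , c) ∷ [])              = Links v c v1
  Chain v1 ((v , c) ∷ (w , d) ∷ rest)  = Links v c w × Chain v1 ((w , d) ∷ rest)

  IsCycle : List Step → Set
  IsCycle []              = ⊥
  IsCycle ((v , c) ∷ rest) =
    Chain v ((v , c) ∷ rest)
    × Unique (map proj₁ ((v , c) ∷ rest))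
    × Unique (map proj₂ ((v , c) ∷ rest))

  IsCycleCoverR : List (List Step) → Set
  IsCycleCoverR C =
      All IsCycle C
    × Unique (map proj₁ (concat C))
    × (∀ v → v ∈ map proj₁ (concat C))
    × (∀ e → kind e ≡ required → e ∈ map proj₂ (concat C))

  CycleCoverR : Set
  CycleCoverR = Σ (List (List Step)) IsCycleCoverR

  -- cycles are identified up to the choice of starting vertex
  SameCycle : List Step → List Step → Set
  SameCycle c d = ∃[ xs ] ∃[ ys ] (c ≡ xs ++ ys × d ≡ ys ++ xs)

  SameCover : CycleCoverR → CycleCoverR → Set
  SameCover (C , _) (D , _) = ∃[ C' ] (Pointwise SameCycle C C' × C' ↭ D)

Point : ℕ → ℕ → Set
Point a b = Fin (suc a) × Fin (suc b)

_≟P_ : ∀ {a b} → (p q : Point a b) → Dec (p ≡ q)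
_≟P_ = ≡-dec F._≟_ F._≟_

data Seg (a b : ℕ) : Set where
  hor : Fin a → Fin (suc b) → Seg a b
  ver : Fin (suc a) → Fin b → Seg a b

end : ∀ {a b} → Seg a b → Bool → Point a b
end (hor i j) false = (inject₁ i , j)
end (hor i j) true  = (fsuc i , j)
end (ver i j) false = (i , inject₁ j)
end (ver i j) true  = (i , fsuc j)

allSegs : ∀ a b → List (Seg a b)
allSegs a b = map (λ ij → hor (proj₁ ij) (proj₂ ij)) (cartesianProduct (allFin a) (allFin (suc b)))
           ++ map (λ ij → ver (proj₁ ij) (proj₂ ij)) (cartesianProduct (allFin (suc a)) (allFin b))

Adjacent : ∀ {a b} → Point a b → Point a b → Set
Adjacent {a} {b} p q = ∃[ s ] ∃[ o ] (end {a} {b} s o ≡ p × end s (not o) ≡ q)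

pairs : ∀ {A : Set} → List A → List (A × A)
pairs []            = []
pairs (x ∷ [])      = []
pairs (x ∷ y ∷ xs)  = (x , y) ∷ pairs (y ∷ xs)

degH : ∀ {a b} → Point a b → ℕ
degH {a} {b} p = sum (map (λ s → ind′ (end s false ≟P p) + ind′ (end s true ≟P p)) (allSegs a b))
  where
  ind′ : ∀ {P : Set} → Dec P → ℕ
  ind′ d = if does d then 1 else 0

record GridEmbedding (G : MixedGraph) (a b : ℕ) : Set where
  open MixedGraph G
  field
    pos      : Fin nV → Point a b
    posInj   : ∀ u v → pos u ≡ pos v → u ≡ v
    interior : Fin nE → List (Point a b)

  path : Fin nE → List (Point a b)
  path e = pos (tl e) ∷ interior e ++ pos (hd e) ∷ []

  field
    pathAdj    : ∀ e → All (λ pq → Adjacent (proj₁ pq) (proj₂ pq)) (pairs (path e))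
    pathSimple : ∀ e → Unique (path e)
    intDisj    : ∀ e e' p → p ∈ interior e → p ∈ path e' → e ≡ e'
    intNoVert  : ∀ e v → pos v ∉ interior e
    segDisj    : ∀ e e' p q → (p , q) ∈ pairs (path e)
                 → ((p , q) ∈ pairs (path e') ⊎ (q , p) ∈ pairs (path e')) → e ≡ e'

-- a flow assigns to each source (segment s) the values on its two
-- out-edges, toward end s false and end s true
Flow : ℕ → ℕ → Set
Flow a b = Seg a b → Bool → ℕ

module _ {G : MixedGraph} {a b : ℕ} (emb : GridEmbedding G a b) where
  open MixedGraph G
  open GridEmbedding emb

  inflow : Flow a b → Point a b → ℕ
  inflow f p = sum (map (λ s → (if does (end s false ≟P p) then f s false else 0)
                             + (if does (end s true ≟P p) then f s true else 0)) (allSegs a b))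

  -- admissible values by source type, in terms of the value sent toward
  -- the endpoint closer to hd e (the designated endpoint for biased sources)
  KindOK : EdgeKind → ℕ → Set
  KindOK directed   x = 1 ≤ x
  KindOK undirected x = ⊤
  KindOK required   x = x ≡ 0 ⊎ x ≡ 2

  Admissible : Flow a b → Seg a b → Set
  Admissible f s =
      (∀ e o → (end s o , end s (not o)) ∈ pairs (path e) → KindOK (kind e) (f s (not o)))
    × ((∀ e o → (end s o , end s (not o)) ∉ pairs (path e))
         → f s false ≡ 1 × f s true ≡ 1)

  IsFlow : Flow a b → Set
  IsFlow f =
      (∀ s → f s false + f s true ≡ 2)
    × (∀ p → inflow f p ≡ degH p)
    × (∀ s → Admissible f s)

  FlowN : Set
  FlowN = Σ (Flow a b) IsFlow

  SameFlow : FlowN → FlowN → Set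
  SameFlow (f , _) (g , _) = ∀ s o → f s o ≡ g s o

-- Bijection between the classes of CycleCoverR G (modulo SameCover) and
-- FlowN (flows compared pointwise)

record Bijection {A B : Set} (_≈A_ : A → A → Set) (_≈B_ : B → B → Set) : Set where
  field
    to        : A → B
    cong      : ∀ x y → x ≈A y → to x ≈B to y
    injective : ∀ x y → to x ≈B to y → x ≈A y
    surjective : ∀ z → ∃[ x ] (to x ≈B z)

-- A cycle cover is recorded by its orientation: every edge is traversed
-- forward, backward or not at all. Covers agree up to rotating and reordering
-- their cycles exactly when their orientations agree, and an orientation comes
-- from a cover exactly when it respects the edge kinds and every vertex has one
-- leaving and one entering edge; the cover is recovered by joining the leaving
-- steps into closed trails. An orientation becomes a flow by sending 2, 1 or 0
-- towards the head along every segment of a forward, unused or backward edge,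
-- and 1 each way along unused grid segments; conservation at the interior
-- points of an edge path shows that every flow is of this form. At a vertex the
-- sink condition says that the values arriving along its three edges sum to 3;
-- as the required edge does not carry 1, this happens exactly when one edge
-- leaves and one enters.

module Submission where

open import Defs
import Data.Nat as Nat
open import Data.Nat using (ℕ; zero; suc; _+_; _≤_; z≤n; s≤s)
open import Data.Nat.Properties using (m≤n+m; 1+n≢n; m≢1+m+n; +-comm; +-identityʳ; +-cancelˡ-≡; +-cancelʳ-≡)
open import Data.Nat.ListAction using (sum)
open import Algebra.Properties.CommutativeSemigroup Data.Nat.Properties.+-commutativeSemigroup
  using () renaming (interchange to +-interchange)
open import Data.Fin using (Fin; inject₁; toℕ) renaming (suc to fsuc)
import Data.Fin as Fin
open import Data.Fin.Properties using (toℕ-inject₁; inject₁-injective)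
import Data.Fin.Properties as Finₚ
open import Data.Bool using (Bool; true; false; not; if_then_else_)
open import Data.List using (List; []; _∷_; _++_; [_]; map; concat; length; allFin; filter; cartesianProduct)
open import Data.List.Properties using (map-++; map-∘; map-cong; length-map; ++-identityʳ; ++-assoc; map-cong-local)
open import Data.List.Membership.Propositional using (_∈_; _∉_; find; lose)
open import Data.List.Relation.Binary.Subset.Propositional using (_⊆_)
open import Data.List.Relation.Binary.Pointwise using (Pointwise; []; _∷_)
open import Data.List.Membership.Propositional.Properties
  using (∈-∃++; ∈-map⁺; ∈-map⁻; ∈-++⁺ˡ; ∈-++⁺ʳ; ∈-++⁻; ∈-concat⁺′; ∈-concat⁻′;
         ∈-allFin; ∈-filter⁺; ∈-filter⁻; ∈-cartesianProduct⁺)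
open import Data.List.Relation.Unary.Any as Any using (Any; here; there)
import Data.List.Relation.Unary.Any.Properties as Anyₚ
open import Data.List.Relation.Unary.All as All using (All; []; _∷_)
import Data.List.Relation.Unary.All.Properties as Allₚ
open import Data.List.Relation.Unary.AllPairs as AllPairs using (AllPairs; []; _∷_)
import Data.List.Relation.Unary.AllPairs.Properties as AllPairsₚ
open import Data.List.Relation.Unary.Unique.Propositional using (Unique)
import Data.List.Relation.Unary.Unique.Propositional.Properties as Uniqueₚ
open Uniqueₚ using (Unique[x∷xs]⇒x∉xs)
open import Data.List.Relation.Binary.Permutation.Propositional using (_↭_; refl; prep; swap; trans; ↭-sym; ↭-reflexive)
open import Data.List.Relation.Binary.Permutation.Propositional.Properties
  using (All-resp-↭; ∈-resp-↭; shift; shifts; ∷↭∷ʳ)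
import Data.List.Relation.Binary.Permutation.Propositional.Properties as ↭
open import Data.Product using (Σ; ∃; ∃!; ∃-syntax; _×_; _,_; proj₁; proj₂)
open import Data.Sum using (_⊎_; inj₁; inj₂)
open import Data.Empty using (⊥; ⊥-elim)
open import Function using (_∘_)
open import Relation.Nullary using (¬_; Dec; yes; no; does)
open import Relation.Nullary.Decidable using (_⊎-dec_; _×-dec_; _→-dec_; ¬?; map′; toWitness)
import Data.List.Membership.DecPropositional as Membership
open import Relation.Binary.Definitions using (DecidableEquality)
open import Data.Product.Properties using (≡-dec)
open import Relation.Binary.PropositionalEquality
  using (_≡_; _≢_; refl; sym; cong; cong₂; subst; subst₂; module ≡-Reasoning)
  renaming (trans to ≡-trans)

private variable
  A B : Set
  x y z : A
  xs ys : List A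

Unique-resp-↭ : xs ↭ ys → Unique xs → Unique ys
Unique-resp-↭ refl u = u
Unique-resp-↭ (prep x p) (x∉ ∷ u) = All-resp-↭ p x∉ ∷ Unique-resp-↭ p u
Unique-resp-↭ (swap x y p) ((x≢y ∷ x∉) ∷ y∉ ∷ u) =
  ((λ y≡x → x≢y (sym y≡x)) ∷ All-resp-↭ p y∉) ∷ All-resp-↭ p x∉ ∷ Unique-resp-↭ p u
Unique-resp-↭ (trans p q) u = Unique-resp-↭ q (Unique-resp-↭ p u)

Unique-++⁻ˡ : ∀ (xs : List A) → Unique (xs ++ ys) → Unique xs
Unique-++⁻ˡ []       u         = []
Unique-++⁻ˡ (x ∷ xs) (x∉ ∷ u) = Allₚ.++⁻ˡ xs x∉ ∷ Unique-++⁻ˡ xs u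

Unique-++⁻ʳ : ∀ (xs : List A) → Unique (xs ++ ys) → Unique ys
Unique-++⁻ʳ []       u       = u
Unique-++⁻ʳ (x ∷ xs) (_ ∷ u) = Unique-++⁻ʳ xs u

Unique-++⇒disjoint : ∀ (xs : List A) → Unique (xs ++ ys) → x ∈ xs → x ∉ ys
Unique-++⇒disjoint (x ∷ xs) (x∉ ∷ u) (here refl) x∈ys = All.lookup x∉ (∈-++⁺ʳ xs x∈ys) refl
Unique-++⇒disjoint (x ∷ xs) (_ ∷ u)  (there x∈)  x∈ys = Unique-++⇒disjoint xs u x∈ x∈ys

Unique-map⇒injectiveOn : ∀ (f : A → B) → Unique (map f xs) → x ∈ xs → y ∈ xs → f x ≡ f y → x ≡ y
Unique-map⇒injectiveOn f u (here refl) (here refl) _ = refl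
Unique-map⇒injectiveOn f (fx∉ ∷ u) (here refl) (there y∈) eq = ⊥-elim (All.lookup fx∉ (∈-map⁺ f y∈) eq)
Unique-map⇒injectiveOn f (fy∉ ∷ u) (there x∈) (here refl) eq = ⊥-elim (All.lookup fy∉ (∈-map⁺ f x∈) (sym eq))
Unique-map⇒injectiveOn f (_ ∷ u) (there x∈) (there y∈) eq = Unique-map⇒injectiveOn f u x∈ y∈ eq

Unique-map⁺-injectiveOn : ∀ (f : A → B) → Unique xs
  → (∀ {x y} → x ∈ xs → y ∈ xs → f x ≡ f y → x ≡ y) → Unique (map f xs)
Unique-map⁺-injectiveOn f []        inj = []
Unique-map⁺-injectiveOn f (x∉ ∷ u) inj =
  All.tabulate fx∉ ∷ Unique-map⁺-injectiveOn f u (λ p q → inj (there p) (there q))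
  where
  fx∉ : ∀ {z} → z ∈ map f _ → f _ ≢ z
  fx∉ z∈ eq with ∈-map⁻ f z∈
  ... | y , y∈ , refl = All.lookup x∉ y∈ (inj (here refl) (there y∈) eq)

∈⇒↭∷ : x ∈ xs → ∃[ ys ] (xs ↭ x ∷ ys)
∈⇒↭∷ {x = x} x∈ with ∈-∃++ x∈
... | ys , zs , refl = ys ++ zs , shift x ys zs

↭-concat⁺ : ∀ {xss yss : List (List A)} → xss ↭ yss → concat xss ↭ concat yss
↭-concat⁺ refl         = refl
↭-concat⁺ (prep xs p)  = ↭.++⁺ˡ xs (↭-concat⁺ p)
↭-concat⁺ (swap xs ys p) = trans (shifts xs ys) (↭.++⁺ˡ ys (↭.++⁺ˡ xs (↭-concat⁺ p)))
↭-concat⁺ (trans p q)  = trans (↭-concat⁺ p) (↭-concat⁺ q)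

sum-map-↭∷ : ∀ (φ : A → ℕ) → xs ↭ x ∷ ys → sum (map φ xs) ≡ φ x + sum (map φ ys)
sum-map-↭∷ φ p = sum-↭ (↭.map⁺ φ p)
  where open import Data.Nat.ListAction.Properties using (sum-↭)

sum-map-exchange : ∀ (φ ψ : A → ℕ) (U L : List A) → Unique U → Unique L
  → L ⊆ U → (∀ {u} → u ∈ U → u ∉ L → φ u ≡ ψ u)
  → sum (map φ U) + sum (map ψ L) ≡ sum (map ψ U) + sum (map φ L)
sum-map-exchange φ ψ U [] uU uL L⊆U φ≗ψ =
  cong (λ n → sum n + 0) (map-cong-local (All.tabulate (λ u∈ → φ≗ψ u∈ λ ())))
sum-map-exchange φ ψ U (l ∷ L) uU (l∉L ∷ uL) L⊆U φ≗ψ = begin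
  sum (map φ U) + (ψ l + sum (map ψ L))          ≡⟨ cong (_+ (ψ l + sum (map ψ L))) (sum-map-↭∷ φ U↭) ⟩
  (φ l + sum (map φ U′)) + (ψ l + sum (map ψ L)) ≡⟨ +-exchange (φ l) (ψ l) _ _ _ _ ih ⟩
  (ψ l + sum (map ψ U′)) + (φ l + sum (map φ L)) ≡⟨ cong (_+ (φ l + sum (map φ L))) (sym (sum-map-↭∷ ψ U↭)) ⟩
  sum (map ψ U) + (φ l + sum (map φ L))          ∎
  where
  open ≡-Reasoning
  U′ = proj₁ (∈⇒↭∷ (L⊆U (here refl)))
  U↭ = proj₂ (∈⇒↭∷ (L⊆U (here refl)))
  l∷U′ : Unique (l ∷ U′)
  l∷U′ = Unique-resp-↭ U↭ uU
  L⊆U′ : L ⊆ U′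
  L⊆U′ {m} m∈ with ∈-resp-↭ U↭ (L⊆U (there m∈))
  ... | here refl = ⊥-elim (All.lookup l∉L m∈ refl)
  ... | there m∈U′ = m∈U′
  φ≗ψ′ : ∀ {u} → u ∈ U′ → u ∉ L → φ u ≡ ψ u
  φ≗ψ′ {u} u∈ u∉ = φ≗ψ (∈-resp-↭ (↭-sym U↭) (there u∈)) λ
    { (here refl) → Unique[x∷xs]⇒x∉xs l∷U′ u∈ ; (there u∈L) → u∉ u∈L }
  ih = sum-map-exchange φ ψ U′ L (AllPairs.tail l∷U′) uL L⊆U′ φ≗ψ′
  +-exchange : ∀ a b c d e f → c + d ≡ e + f → (a + c) + (b + d) ≡ (b + e) + (a + f)
  +-exchange a b c d e f h = begin
    (a + c) + (b + d) ≡⟨ +-interchange a c b d ⟩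
    (a + b) + (c + d) ≡⟨ cong₂ _+_ (+-comm a b) h ⟩
    (b + a) + (e + f) ≡⟨ +-interchange b a e f ⟩
    (b + e) + (a + f) ∎

ExactlyOne : (A → Set) → List A → Set
ExactlyOne P xs = Any P xs × AllPairs (λ x y → ¬ (P x × P y)) xs

AllPairs-exclusive⇒unique : ∀ {P : A → Set} → AllPairs (λ x y → ¬ (P x × P y)) xs
  → x ∈ xs → y ∈ xs → P x → P y → x ≡ y
AllPairs-exclusive⇒unique _       (here refl) (here refl) _  _  = refl
AllPairs-exclusive⇒unique (h ∷ _) (here refl) (there y∈)  px py = ⊥-elim (All.lookup h y∈ (px , py))
AllPairs-exclusive⇒unique (h ∷ _) (there x∈)  (here refl) px py = ⊥-elim (All.lookup h x∈ (py , px))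
AllPairs-exclusive⇒unique (_ ∷ t) (there x∈)  (there y∈)  px py = AllPairs-exclusive⇒unique t x∈ y∈ px py

Unique⇒AllPairs-exclusive : ∀ {P : A → Set} → Unique xs
  → (∀ {x y} → x ∈ xs → y ∈ xs → P x → P y → x ≡ y) → AllPairs (λ x y → ¬ (P x × P y)) xs
Unique⇒AllPairs-exclusive []        _    = []
Unique⇒AllPairs-exclusive (x∉ ∷ u) same =
  All.tabulate (λ y∈ pxy → All.lookup x∉ y∈ (same (here refl) (there y∈) (proj₁ pxy) (proj₂ pxy)))
  ∷ Unique⇒AllPairs-exclusive u (λ p q → same (there p) (there q))

ExactlyOne-map⇔∃! : ∀ (f : A → B) {P : B → Set} {Q : A → Set} → Unique xs
  → (∀ {x} → Q x → x ∈ xs × P (f x)) → (∀ {x} → x ∈ xs → P (f x) → Q x)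
  → (ExactlyOne P (map f xs) → ∃! _≡_ Q) × (∃! _≡_ Q → ExactlyOne P (map f xs))
ExactlyOne-map⇔∃! f {P} {Q} u Q⇒ ⇒Q = to , from
  where
  to : ExactlyOne P (map f _) → ∃! _≡_ Q
  to (some , exclusive) with find (Anyₚ.map⁻ some)
  ... | x , x∈ , px = x , ⇒Q x∈ px , λ qy →
    AllPairs-exclusive⇒unique (AllPairsₚ.map⁻ exclusive) x∈ (proj₁ (Q⇒ qy)) px (proj₂ (Q⇒ qy))
  from : ∃! _≡_ Q → ExactlyOne P (map f _)
  from (x , qx , unique) =
      Anyₚ.map⁺ (lose (proj₁ (Q⇒ qx)) (proj₂ (Q⇒ qx)))
    , AllPairsₚ.map⁺ (Unique⇒AllPairs-exclusive u
        (λ y∈ z∈ py pz → ≡-trans (sym (unique (⇒Q y∈ py))) (unique (⇒Q z∈ pz))))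

∈-pairs⁻ : ∀ {xs : List A} → (x , y) ∈ pairs xs → x ∈ xs × y ∈ xs
∈-pairs⁻ {xs = _ ∷ _ ∷ _}  (here refl) = here refl , there (here refl)
∈-pairs⁻ {xs = _ ∷ ys@(_ ∷ _)} (there p) with ∈-pairs⁻ {xs = ys} p
... | x∈ , y∈ = there x∈ , there y∈

pairs-head-noPredecessor : Unique (x ∷ xs) → (y , x) ∉ pairs (x ∷ xs)
pairs-head-noPredecessor {xs = _ ∷ _} u (here refl) = Unique[x∷xs]⇒x∉xs u (here refl)
pairs-head-noPredecessor {xs = _ ∷ _} u (there p)   = Unique[x∷xs]⇒x∉xs u (proj₂ (∈-pairs⁻ p))

pairs-last-noSuccessor : ∀ (xs : List A) → Unique (xs ++ [ x ]) → (x , y) ∉ pairs (xs ++ [ x ])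
pairs-last-noSuccessor (_ ∷ [])          u (here refl) = Unique[x∷xs]⇒x∉xs u (here refl)
pairs-last-noSuccessor (_ ∷ xs@(_ ∷ _)) u (here refl) = Unique[x∷xs]⇒x∉xs u (∈-++⁺ʳ xs (here refl))
pairs-last-noSuccessor (_ ∷ xs@(_ ∷ _)) u (there p)   = pairs-last-noSuccessor xs (AllPairs.tail u) p

pairs-successor-unique : Unique xs → (x , y) ∈ pairs xs → (x , z) ∈ pairs xs → y ≡ z
pairs-successor-unique {xs = _ ∷ _ ∷ _} u (here refl) (here refl) = refl
pairs-successor-unique {xs = _ ∷ _ ∷ _} u (here refl) (there q) =
  ⊥-elim (Unique[x∷xs]⇒x∉xs u (proj₁ (∈-pairs⁻ q)))
pairs-successor-unique {xs = _ ∷ _ ∷ _} u (there p) (here refl) =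
  ⊥-elim (Unique[x∷xs]⇒x∉xs u (proj₁ (∈-pairs⁻ p)))
pairs-successor-unique {xs = _ ∷ _ ∷ _} u (there p) (there q) =
  pairs-successor-unique (AllPairs.tail u) p q

pairs-predecessor-unique : Unique xs → (x , z) ∈ pairs xs → (y , z) ∈ pairs xs → x ≡ y
pairs-predecessor-unique {xs = _ ∷ _ ∷ _} u (here refl) (here refl) = refl
pairs-predecessor-unique {xs = _ ∷ _ ∷ _} u (here refl) (there q) =
  ⊥-elim (pairs-head-noPredecessor (AllPairs.tail u) q)
pairs-predecessor-unique {xs = _ ∷ _ ∷ _} u (there p) (here refl) =
  ⊥-elim (pairs-head-noPredecessor (AllPairs.tail u) p)
pairs-predecessor-unique {xs = _ ∷ _ ∷ _} u (there p) (there q) =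
  pairs-predecessor-unique (AllPairs.tail u) p q

pairs-asym : ∀ {xs : List A} {x y} → Unique xs → (x , y) ∈ pairs xs → (y , x) ∉ pairs xs
pairs-asym {xs = _ ∷ _ ∷ _} u (here refl) (here eq) = Unique[x∷xs]⇒x∉xs u (here (sym (cong proj₁ eq)))
pairs-asym {xs = _ ∷ _ ∷ _} u (here refl) (there q) = Unique[x∷xs]⇒x∉xs u (proj₂ (∈-pairs⁻ q))
pairs-asym {xs = _ ∷ _ ∷ _} u (there p) (here refl) = Unique[x∷xs]⇒x∉xs u (proj₂ (∈-pairs⁻ p))
pairs-asym {xs = _ ∷ _ ∷ _} u (there p) (there q) = pairs-asym (AllPairs.tail u) p q

∈⇒successor : y ∈ xs → ∃[ w ] ((y , w) ∈ pairs (xs ++ [ z ]))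
∈⇒successor {xs = _ ∷ []}     {z} (here refl) = z , here refl
∈⇒successor {xs = _ ∷ x ∷ _}      (here refl) = x , here refl
∈⇒successor {xs = _ ∷ _ ∷ _}      (there p) with ∈⇒successor p
... | w , q = w , there q

∈⇒predecessor : y ∈ xs → ∃[ w ] ((w , y) ∈ pairs (x ∷ xs))
∈⇒predecessor {x = x} (here refl) = x , here refl
∈⇒predecessor         (there p) with ∈⇒predecessor p
... | w , q = w , there q

pairs-propagate : ∀ (Q : A × A → Set) (xs : List A)
  → (∀ {y} → (x , y) ∈ pairs (x ∷ xs) → Q (x , y))
  → (∀ {u v w} → (u , v) ∈ pairs (x ∷ xs) → (v , w) ∈ pairs (x ∷ xs) → Q (u , v) → Q (v , w))
  → ∀ {p} → p ∈ pairs (x ∷ xs) → Q p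
pairs-propagate Q (y ∷ xs) first step (here refl) = first (here refl)
pairs-propagate Q (y ∷ xs) first step (there p) =
  pairs-propagate Q xs (λ q → step (here refl) (there q) (first (here refl)))
                       (λ p q → step (there p) (there q)) p

-- Grid segments

inject₁≢suc : ∀ {n} (i : Fin n) → inject₁ i ≢ fsuc i
inject₁≢suc i eq = 1+n≢n (sym (≡-trans (sym (toℕ-inject₁ i)) (cong toℕ eq)))

inject₁≡suc⇒suc≢inject₁ : ∀ {n} (i j : Fin n) → inject₁ i ≡ fsuc j → fsuc i ≢ inject₁ j
inject₁≡suc⇒suc≢inject₁ i j eq eq′ = m≢1+m+n (toℕ j) {1} (begin
  toℕ j                  ≡⟨ sym (toℕ-inject₁ j) ⟩
  toℕ (inject₁ j)        ≡⟨ cong toℕ (sym eq′) ⟩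
  suc (toℕ i)            ≡⟨ cong suc (≡-trans (sym (toℕ-inject₁ i)) (cong toℕ eq)) ⟩
  suc (suc (toℕ j))      ≡⟨ cong suc (+-comm 1 (toℕ j)) ⟩
  suc (toℕ j + 1)        ∎)
  where open ≡-Reasoning

module _ {a b : ℕ} where

  endpoints : Seg a b → Bool → Point a b × Point a b
  endpoints s o = end s o , end s (not o)

  end-false≢end-true : ∀ (s : Seg a b) → end s false ≢ end s true
  end-false≢end-true (hor i j) eq = inject₁≢suc i (cong proj₁ eq)
  end-false≢end-true (ver i j) eq = inject₁≢suc j (cong proj₂ eq)

  end≢end-not : ∀ (s : Seg a b) o → end s o ≢ end s (not o)
  end≢end-not s false = end-false≢end-true s
  end≢end-not s true  = λ eq → end-false≢end-true s (sym eq)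

  private
    same-ends : ∀ (s s′ : Seg a b) → end s false ≡ end s′ false → end s true ≡ end s′ true → s ≡ s′
    same-ends (hor i j) (hor i′ j′) e₀ e₁ = cong₂ hor (inject₁-injective (cong proj₁ e₀)) (cong proj₂ e₀)
    same-ends (ver i j) (ver i′ j′) e₀ e₁ = cong₂ ver (cong proj₁ e₀) (inject₁-injective (cong proj₂ e₀))
    same-ends (hor i j) (ver i′ j′) e₀ e₁ = ⊥-elim (inject₁≢suc i (≡-trans (cong proj₁ e₀) (sym (cong proj₁ e₁))))
    same-ends (ver i j) (hor i′ j′) e₀ e₁ = ⊥-elim (inject₁≢suc j (≡-trans (cong proj₂ e₀) (sym (cong proj₂ e₁))))

    crossed-ends : ∀ (s s′ : Seg a b) → end s false ≡ end s′ true → end s true ≢ end s′ false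
    crossed-ends (hor i j) (hor i′ j′) e₀ e₁ = inject₁≡suc⇒suc≢inject₁ i i′ (cong proj₁ e₀) (cong proj₁ e₁)
    crossed-ends (ver i j) (ver i′ j′) e₀ e₁ = inject₁≡suc⇒suc≢inject₁ j j′ (cong proj₂ e₀) (cong proj₂ e₁)
    crossed-ends (hor i j) (ver i′ j′) e₀ e₁ = inject₁≢suc i (≡-trans (cong proj₁ e₀) (sym (cong proj₁ e₁)))
    crossed-ends (ver i j) (hor i′ j′) e₀ e₁ = inject₁≢suc j (≡-trans (cong proj₂ e₀) (sym (cong proj₂ e₁)))

  endpoints-injective : ∀ {s s′ : Seg a b} {o o′} → endpoints s o ≡ endpoints s′ o′ → s ≡ s′ × o ≡ o′
  endpoints-injective {s} {s′} {false} {false} eq = same-ends s s′ (cong proj₁ eq) (cong proj₂ eq) , refl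
  endpoints-injective {s} {s′} {true}  {true}  eq = same-ends s s′ (cong proj₂ eq) (cong proj₁ eq) , refl
  endpoints-injective {s} {s′} {false} {true}  eq = ⊥-elim (crossed-ends s s′ (cong proj₁ eq) (cong proj₂ eq))
  endpoints-injective {s} {s′} {true}  {false} eq =
    ⊥-elim (crossed-ends s′ s (sym (cong proj₁ eq)) (sym (cong proj₂ eq)))

  ∈-allSegs : ∀ (s : Seg a b) → s ∈ allSegs a b
  ∈-allSegs (hor i j) = ∈-++⁺ˡ (∈-map⁺ _ (∈-cartesianProduct⁺ (∈-allFin i) (∈-allFin j)))
  ∈-allSegs (ver i j) = ∈-++⁺ʳ _ (∈-map⁺ _ (∈-cartesianProduct⁺ (∈-allFin i) (∈-allFin j)))

  allSegs-unique : Unique (allSegs a b)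
  allSegs-unique =
    Uniqueₚ.++⁺ (Uniqueₚ.map⁺ hor-injective (Uniqueₚ.cartesianProduct⁺ (Uniqueₚ.allFin⁺ a) (Uniqueₚ.allFin⁺ (suc b))))
                (Uniqueₚ.map⁺ ver-injective (Uniqueₚ.cartesianProduct⁺ (Uniqueₚ.allFin⁺ (suc a)) (Uniqueₚ.allFin⁺ b)))
                hor≢ver
    where
    hor-injective : ∀ {x y : Fin a × Fin (suc b)} → hor (proj₁ x) (proj₂ x) ≡ hor (proj₁ y) (proj₂ y) → x ≡ y
    hor-injective refl = refl
    ver-injective : ∀ {x y : Fin (suc a) × Fin b} → ver (proj₁ x) (proj₂ x) ≡ ver (proj₁ y) (proj₂ y) → x ≡ y
    ver-injective refl = refl
    hor≢ver : ∀ {s} → ¬ (s ∈ map _ (cartesianProduct (allFin a) (allFin (suc b)))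
                         × s ∈ map _ (cartesianProduct (allFin (suc a)) (allFin b)))
    hor≢ver (p , q) with ∈-map⁻ _ p | ∈-map⁻ _ q
    ... | _ , _ , refl | _ , _ , ()

-- Cycle covers and orientations

data EdgeUse : Set where
  forward unused backward : EdgeUse

reverse : EdgeUse → EdgeUse
reverse forward  = backward
reverse unused   = unused
reverse backward = forward

-- The flow a segment of the edge sends towards the head of the edge.
headward : EdgeUse → ℕ
headward forward  = 2
headward unused   = 1
headward backward = 0

reverse-involutive : ∀ d → reverse (reverse d) ≡ d
reverse-involutive forward  = refl
reverse-involutive unused   = refl
reverse-involutive backward = refl

reverse-injective : ∀ {d d′} → reverse d ≡ reverse d′ → d ≡ d′
reverse-injective {d} {d′} eq = ≡-trans (sym (reverse-involutive d)) (≡-trans (cong reverse eq) (reverse-involutive d′))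

headward-injective : ∀ {d d′} → headward d ≡ headward d′ → d ≡ d′
headward-injective {forward}  {forward}  _ = refl
headward-injective {unused}   {unused}   _ = refl
headward-injective {backward} {backward} _ = refl
headward-injective {forward}  {unused}   ()
headward-injective {forward}  {backward} ()
headward-injective {unused}   {forward}  ()
headward-injective {unused}   {backward} ()
headward-injective {backward} {forward}  ()
headward-injective {backward} {unused}   ()

headward-surjective : ∀ {n} → n ≤ 2 → ∃[ d ] (headward d ≡ n)
headward-surjective z≤n             = backward , refl
headward-surjective (s≤s z≤n)       = unused , refl
headward-surjective (s≤s (s≤s z≤n)) = forward , refl

headward-reverse : ∀ d → headward d + headward (reverse d) ≡ 2
headward-reverse forward  = refl
headward-reverse unused   = refl
headward-reverse backward = refl

module _ (G : MixedGraph) where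
  open MixedGraph G

  Leaves Enters : (Fin nE → EdgeUse) → Fin nV → Fin nE → Set
  Leaves x v e = (tl e ≡ v × x e ≡ forward) ⊎ (hd e ≡ v × x e ≡ backward)
  Enters x v e = (hd e ≡ v × x e ≡ forward) ⊎ (tl e ≡ v × x e ≡ backward)

  KindCompatible : (Fin nE → EdgeUse) → Set
  KindCompatible x = ∀ e → (kind e ≡ directed → x e ≢ backward) × (kind e ≡ required → x e ≢ unused)

  record IsCoverOrientation (x : Fin nE → EdgeUse) : Set where
    field
      kindCompatible  : KindCompatible x
      leaving        : ∀ v → ∃! _≡_ (Leaves x v)
      entering       : ∀ v → ∃! _≡_ (Enters x v)

  Leaves-injective : ∀ {x v v′ e} → Leaves x v e → Leaves x v′ e → v ≡ v′
  Leaves-injective (inj₁ (t , _))  (inj₁ (t′ , _))  = ≡-trans (sym t) t′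
  Leaves-injective (inj₁ (_ , xf)) (inj₂ (_ , xb)) with ≡-trans (sym xf) xb
  ... | ()
  Leaves-injective (inj₂ (_ , xb)) (inj₁ (_ , xf)) with ≡-trans (sym xf) xb
  ... | ()
  Leaves-injective (inj₂ (h , _))  (inj₂ (h′ , _))  = ≡-trans (sym h) h′

  Leaves-cong : ∀ {x y v e} → x e ≡ y e → Leaves x v e → Leaves y v e
  Leaves-cong eq (inj₁ (t , xf)) = inj₁ (t , ≡-trans (sym eq) xf)
  Leaves-cong eq (inj₂ (h , xb)) = inj₂ (h , ≡-trans (sym eq) xb)

  Leaves-forward : ∀ {x} e → x e ≡ forward → Leaves x (tl e) e
  Leaves-forward e xf = inj₁ (refl , xf)

  Leaves-backward : ∀ {x} e → x e ≡ backward → Leaves x (hd e) e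
  Leaves-backward e xb = inj₂ (refl , xb)

  Leaves⇒used : ∀ {x v e} → Leaves x v e → x e ≢ unused
  Leaves⇒used (inj₁ (_ , xf)) xu with ≡-trans (sym xf) xu
  ... | ()
  Leaves⇒used (inj₂ (_ , xb)) xu with ≡-trans (sym xb) xu
  ... | ()

  Leaves⇔⇒≗ : ∀ {x y} → (∀ {v e} → Leaves x v e → Leaves y v e) → (∀ {v e} → Leaves y v e → Leaves x v e)
            → ∀ e → x e ≡ y e
  Leaves⇔⇒≗ {x} {y} x⇒y y⇒x e with x e in xe | y e in ye
  ... | forward  | _ = leaves-at-tl (x⇒y (Leaves-forward {x} e xe)) ye
    where
    leaves-at-tl : ∀ {d} → Leaves y (tl e) e → y e ≡ d → forward ≡ d
    leaves-at-tl (inj₁ (_ , yf)) refl = sym yf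
    leaves-at-tl (inj₂ (h , _))  _    = ⊥-elim (noLoop e (sym h))
  ... | backward | _ = leaves-at-hd (x⇒y (Leaves-backward {x} e xe)) ye
    where
    leaves-at-hd : ∀ {d} → Leaves y (hd e) e → y e ≡ d → backward ≡ d
    leaves-at-hd (inj₁ (t , _))  _    = ⊥-elim (noLoop e t)
    leaves-at-hd (inj₂ (_ , yb)) refl = sym yb
  ... | unused   | forward  = ⊥-elim (Leaves⇒used {x} (y⇒x (Leaves-forward {y} e ye)) xe)
  ... | unused   | backward = ⊥-elim (Leaves⇒used {x} (y⇒x (Leaves-backward {y} e ye)) xe)
  ... | unused   | unused   = refl

  Links⇒ends : ∀ {v c w} → Links G v c w → (tl c ≡ v × hd c ≡ w) ⊎ (tl c ≡ w × hd c ≡ v × kind c ≢ directed)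
  Links⇒ends (inj₁ (_ , t , h))         = inj₁ (t , h)
  Links⇒ends (inj₂ (_ , inj₁ (t , h))) = inj₁ (t , h)
  Links⇒ends (inj₂ (k , inj₂ (t , h))) = inj₂ (t , h , k)

  Links-forward : ∀ c → Links G (tl c) c (hd c)
  Links-forward c with kind c
  ... | directed   = inj₁ (refl , refl , refl)
  ... | undirected = inj₂ ((λ ()) , inj₁ (refl , refl))
  ... | required   = inj₂ ((λ ()) , inj₁ (refl , refl))

  Links-backward : ∀ c → kind c ≢ directed → Links G (hd c) c (tl c)
  Links-backward c k = inj₂ (k , inj₂ (refl , refl))

  Links-functional : ∀ {v c w w′} → Links G v c w → Links G v c w′ → w ≡ w′
  Links-functional {c = c} l l′ with Links⇒ends l | Links⇒ends l′
  ... | inj₁ (t , h)     | inj₁ (t′ , h′)     = ≡-trans (sym h) h′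
  ... | inj₁ (t , h)     | inj₂ (t′ , h′ , _) = ⊥-elim (noLoop c (≡-trans t (sym h′)))
  ... | inj₂ (t , h , _) | inj₁ (t′ , h′)     = ⊥-elim (noLoop c (≡-trans t′ (sym h)))
  ... | inj₂ (t , h , _) | inj₂ (t′ , h′ , _) = ≡-trans (sym t) t′

  Links-irreflexive : ∀ {v c w} → Links G v c w → v ≢ w
  Links-irreflexive {c = c} l refl with Links⇒ends l
  ... | inj₁ (t , h)     = noLoop c (≡-trans t (sym h))
  ... | inj₂ (t , h , _) = noLoop c (≡-trans t (sym h))

  Links-other-end : ∀ {u c w u′ w′} → Links G u c w → Links G u′ c w′ → u ≢ u′ → u′ ≡ w
  Links-other-end l l′ u≢u′ with Links⇒ends l | Links⇒ends l′
  ... | inj₁ (t , h)     | inj₁ (t′ , h′)     = ⊥-elim (u≢u′ (≡-trans (sym t) t′))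
  ... | inj₁ (t , h)     | inj₂ (t′ , h′ , _) = ≡-trans (sym h′) h
  ... | inj₂ (t , h , _) | inj₁ (t′ , h′)     = ≡-trans (sym t′) t
  ... | inj₂ (t , h , _) | inj₂ (t′ , h′ , _) = ⊥-elim (u≢u′ (≡-trans (sym h) h′))

  Leaves∧Links⇒Enters : ∀ {x u c w} → Leaves x u c → Links G u c w → Enters x w c
  Leaves∧Links⇒Enters {c = c} (inj₁ (t , xf)) l with Links⇒ends l
  ... | inj₁ (_ , h)      = inj₁ (h , xf)
  ... | inj₂ (_ , h , _)  = ⊥-elim (noLoop c (≡-trans t (sym h)))
  Leaves∧Links⇒Enters {c = c} (inj₂ (h , xb)) l with Links⇒ends l
  ... | inj₁ (t , _)      = ⊥-elim (noLoop c (≡-trans t (sym h)))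
  ... | inj₂ (t , _ , _)  = inj₂ (t , xb)

  Arc : Set
  Arc = Step G × Fin nV

  IsArc : Arc → Set
  IsArc ((v , c) , w) = Links G v c w

  arcs : Fin nV → List (Step G) → List Arc
  arcs v₁ []              = []
  arcs v₁ (s ∷ [])        = (s , v₁) ∷ []
  arcs v₁ (s ∷ t ∷ ss)    = (s , proj₁ t) ∷ arcs v₁ (t ∷ ss)

  map-proj₁-arcs : ∀ v₁ ss → map proj₁ (arcs v₁ ss) ≡ ss
  map-proj₁-arcs v₁ []           = refl
  map-proj₁-arcs v₁ (s ∷ [])     = refl
  map-proj₁-arcs v₁ (s ∷ t ∷ ss) = cong (s ∷_) (map-proj₁-arcs v₁ (t ∷ ss))

  map-proj₂-arcs : ∀ v₁ s ss → map proj₂ (arcs v₁ (s ∷ ss)) ≡ map proj₁ ss ++ [ v₁ ]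
  map-proj₂-arcs v₁ s []       = refl
  map-proj₂-arcs v₁ s (t ∷ ss) = cong (proj₁ t ∷_) (map-proj₂-arcs v₁ t ss)

  Chain⇒All-IsArc : ∀ v₁ ss → Chain G v₁ ss → All IsArc (arcs v₁ ss)
  Chain⇒All-IsArc v₁ []           _        = []
  Chain⇒All-IsArc v₁ (s ∷ [])     l        = l ∷ []
  Chain⇒All-IsArc v₁ (s ∷ t ∷ ss) (l , ch) = l ∷ Chain⇒All-IsArc v₁ (t ∷ ss) ch

  cycleArcs : List (Step G) → List Arc
  cycleArcs []       = []
  cycleArcs (s ∷ ss) = arcs (proj₁ s) (s ∷ ss)

  map-proj₁-cycleArcs : ∀ c → map proj₁ (cycleArcs c) ≡ c
  map-proj₁-cycleArcs []       = refl
  map-proj₁-cycleArcs (s ∷ ss) = map-proj₁-arcs (proj₁ s) (s ∷ ss)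

  map-proj₂-cycleArcs : ∀ c → map proj₂ (cycleArcs c) ↭ map proj₁ c
  map-proj₂-cycleArcs []       = refl
  map-proj₂-cycleArcs (s ∷ ss) rewrite map-proj₂-arcs (proj₁ s) s ss = ↭-sym (∷↭∷ʳ (proj₁ s) (map proj₁ ss))

  IsCycle⇒All-IsArc : ∀ c → IsCycle G c → All IsArc (cycleArcs c)
  IsCycle⇒All-IsArc (s ∷ ss) (ch , _) = Chain⇒All-IsArc (proj₁ s) (s ∷ ss) ch

  coverArcs : List (List (Step G)) → List Arc
  coverArcs []      = []
  coverArcs (c ∷ C) = cycleArcs c ++ coverArcs C

  map-proj₁-coverArcs : ∀ C → map proj₁ (coverArcs C) ≡ concat C
  map-proj₁-coverArcs []      = refl
  map-proj₁-coverArcs (c ∷ C) = ≡-trans (map-++ proj₁ (cycleArcs c) (coverArcs C))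
                                        (cong₂ _++_ (map-proj₁-cycleArcs c) (map-proj₁-coverArcs C))

  map-proj₂-coverArcs : ∀ C → map proj₂ (coverArcs C) ↭ map proj₁ (concat C)
  map-proj₂-coverArcs []      = refl
  map-proj₂-coverArcs (c ∷ C) rewrite map-++ proj₂ (cycleArcs c) (coverArcs C) | map-++ proj₁ c (concat C) =
    ↭.++⁺ (map-proj₂-cycleArcs c) (map-proj₂-coverArcs C)

  All-IsCycle⇒All-IsArc : ∀ C → All (IsCycle G) C → All IsArc (coverArcs C)
  All-IsCycle⇒All-IsArc []      []         = []
  All-IsCycle⇒All-IsArc (c ∷ C) (cyc ∷ cs) = Allₚ.++⁺ (IsCycle⇒All-IsArc c cyc) (All-IsCycle⇒All-IsArc C cs)

  Enters-injective : ∀ {x v v′ e} → Enters x v e → Enters x v′ e → v ≡ v′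
  Enters-injective (inj₁ (h , _))  (inj₁ (h′ , _))  = ≡-trans (sym h) h′
  Enters-injective (inj₁ (_ , xf)) (inj₂ (_ , xb)) with ≡-trans (sym xf) xb
  ... | ()
  Enters-injective (inj₂ (_ , xb)) (inj₁ (_ , xf)) with ≡-trans (sym xf) xb
  ... | ()
  Enters-injective (inj₂ (t , _))  (inj₂ (t′ , _))  = ≡-trans (sym t) t′

  Enters⇒Leaves : ∀ {x v e} → Enters x v e → ∃[ u ] Leaves x u e
  Enters⇒Leaves {e = e} (inj₁ (_ , xf)) = tl e , inj₁ (refl , xf)
  Enters⇒Leaves {e = e} (inj₂ (_ , xb)) = hd e , inj₂ (refl , xb)

  data Choice (P Q : Set) : EdgeUse → Set where
    forward  : P → Choice P Q forward
    backward : ¬ P → Q → Choice P Q backward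
    unused   : ¬ P → ¬ Q → Choice P Q unused

  choose : ∀ {P Q : Set} → Dec P → Dec Q → ∃ (Choice P Q)
  choose (yes p) _       = forward , forward p
  choose (no ¬p) (yes q) = backward , backward ¬p q
  choose (no ¬p) (no ¬q) = unused , unused ¬p ¬q

  private
    _≟Step_ : DecidableEquality (Step G)
    _≟Step_ = ≡-dec Fin._≟_ Fin._≟_
    open import Data.List.Membership.DecPropositional _≟Step_ using (_∈?_)

  orientation : List (List (Step G)) → Fin nE → EdgeUse
  orientation C e = proj₁ (choose ((tl e , e) ∈? concat C) ((hd e , e) ∈? concat C))

  orientation-choice : ∀ C e → Choice ((tl e , e) ∈ concat C) ((hd e , e) ∈ concat C) (orientation C e)
  orientation-choice C e = proj₂ (choose ((tl e , e) ∈? concat C) ((hd e , e) ∈? concat C))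

  Leaves-orientation⇒∈ : ∀ C {v e} → Leaves (orientation C) v e → (v , e) ∈ concat C
  Leaves-orientation⇒∈ C {e = e} (inj₁ (refl , xf)) with orientation C e | orientation-choice C e
  ... | forward | forward p = p
  Leaves-orientation⇒∈ C (inj₁ (refl , ())) | backward | _
  Leaves-orientation⇒∈ C (inj₁ (refl , ())) | unused   | _
  Leaves-orientation⇒∈ C {e = e} (inj₂ (refl , xb)) with orientation C e | orientation-choice C e
  ... | backward | backward _ q = q
  Leaves-orientation⇒∈ C (inj₂ (refl , ())) | forward | _
  Leaves-orientation⇒∈ C (inj₂ (refl , ())) | unused  | _

  module CoverSteps (C : List (List (Step G))) (cover : IsCycleCoverR G C) where

    private
      S          = concat C
      Arcs       = coverArcs C
      cycles     = proj₁ cover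
      S-unique   = proj₁ (proj₂ cover)
      S-covers   = proj₁ (proj₂ (proj₂ cover))
      S-required = proj₂ (proj₂ (proj₂ cover))

    step⇒arc : ∀ {s} → s ∈ S → ∃[ w ] ((s , w) ∈ Arcs)
    step⇒arc s∈ with ∈-map⁻ proj₁ (subst (_ ∈_) (sym (map-proj₁-coverArcs C)) s∈)
    ... | (_ , w) , a∈ , refl = w , a∈

    arc⇒step : ∀ {s w} → (s , w) ∈ Arcs → s ∈ S
    arc⇒step a∈ = subst (_ ∈_) (map-proj₁-coverArcs C) (∈-map⁺ proj₁ a∈)

    arc⇒IsArc : ∀ {a} → a ∈ Arcs → IsArc a
    arc⇒IsArc = All.lookup (All-IsCycle⇒All-IsArc C cycles)

    targets-unique : Unique (map proj₂ Arcs)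
    targets-unique = Unique-resp-↭ (↭-sym (map-proj₂-coverArcs C)) S-unique

    step-functional : ∀ {v c c′} → (v , c) ∈ S → (v , c′) ∈ S → c ≡ c′
    step-functional p q = cong proj₂ (Unique-map⇒injectiveOn proj₁ S-unique p q refl)

    -- If e were traversed from both of its ends, the cycle through u would
    -- continue from the other end u′ along e again.
    step-edge-injective : ∀ {u u′ e} → (u , e) ∈ S → (u′ , e) ∈ S → u ≡ u′
    step-edge-injective {u} {u′} {e} p q with u Fin.≟ u′
    ... | yes u≡u′ = u≡u′
    ... | no u≢u′ = ⊥-elim (Links-irreflexive u→w u≡w)
      where
      cyc = ∈-concat⁻′ C p
      c = proj₁ cyc
      p∈c = proj₁ (proj₂ cyc)
      c-cycle : IsCycle G c
      c-cycle = All.lookup cycles (proj₂ (proj₂ cyc))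
      arc-in-c : ∃[ w ] (((u , e) , w) ∈ cycleArcs c)
      arc-in-c with ∈-map⁻ proj₁ (subst (_ ∈_) (sym (map-proj₁-cycleArcs c)) p∈c)
      ... | (_ , w) , a∈ , refl = w , a∈
      w = proj₁ arc-in-c
      u→w : Links G u e w
      u→w = All.lookup (IsCycle⇒All-IsArc c c-cycle) (proj₂ arc-in-c)
      u′≡w : u′ ≡ w
      u′≡w = Links-other-end u→w (arc⇒IsArc (proj₂ (step⇒arc q))) u≢u′
      w-step : ∃[ e′ ] ((w , e′) ∈ c)
      w-step with ∈-map⁻ proj₁ (∈-resp-↭ (map-proj₂-cycleArcs c) (∈-map⁺ proj₂ (proj₂ arc-in-c)))
      ... | (_ , e′) , s∈ , refl = e′ , s∈
      we∈c : (w , e) ∈ c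
      we∈c = subst (λ e′ → (w , e′) ∈ c)
                   (step-functional (∈-concat⁺′ (proj₂ w-step) (proj₂ (proj₂ cyc))) (subst (λ z → (z , e) ∈ S) u′≡w q))
                   (proj₂ w-step)
      u≡w : u ≡ w
      u≡w = cong proj₁ (Unique-map⇒injectiveOn proj₂ (edges-unique c c-cycle) p∈c we∈c refl)
        where
        edges-unique : ∀ c → IsCycle G c → Unique (map proj₂ c)
        edges-unique (_ ∷ _) (_ , _ , u) = u

    ∈⇒Leaves : ∀ {v c} → (v , c) ∈ S → Leaves (orientation C) v c
    ∈⇒Leaves {v} {c} s∈ with Links⇒ends (arc⇒IsArc (proj₂ (step⇒arc s∈)))
    ∈⇒Leaves {v} {c} s∈ | inj₁ (refl , _) with orientation C c | orientation-choice C c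
    ... | forward  | _            = inj₁ (refl , refl)
    ... | backward | backward ¬p _ = ⊥-elim (¬p s∈)
    ... | unused   | unused ¬p _   = ⊥-elim (¬p s∈)
    ∈⇒Leaves {v} {c} s∈ | inj₂ (t , refl , _) with orientation C c | orientation-choice C c
    ... | forward  | forward p    = ⊥-elim (noLoop c (step-edge-injective p s∈))
    ... | backward | _            = inj₂ (refl , refl)
    ... | unused   | unused _ ¬q  = ⊥-elim (¬q s∈)

    Enters⇒arc : ∀ {v c} → Enters (orientation C) v c → ∃[ u ] (((u , c) , v) ∈ Arcs)
    Enters⇒arc {v} {c} ent with Enters⇒Leaves {orientation C} ent
    ... | u , lv with step⇒arc (Leaves-orientation⇒∈ C lv)
    ...   | w , a∈ = u , subst (λ z → ((u , c) , z) ∈ Arcs) w≡v a∈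
      where
      w≡v = Enters-injective {orientation C} (Leaves∧Links⇒Enters {orientation C} lv (arc⇒IsArc a∈)) ent

    isCoverOrientation : IsCoverOrientation (orientation C)
    isCoverOrientation = record
      { kindCompatible  = λ e → directed-not-backward e , required-used e
      ; leaving        = leaving
      ; entering       = entering
      }
      where
      directed-not-backward : ∀ e → kind e ≡ directed → orientation C e ≢ backward
      directed-not-backward e k xb with Links⇒ends (arc⇒IsArc (proj₂ (step⇒arc hd-step)))
        where hd-step = Leaves-orientation⇒∈ C (Leaves-backward {orientation C} e xb)
      ... | inj₁ (t , _)     = noLoop e t
      ... | inj₂ (_ , _ , k′) = k′ k
      required-used : ∀ e → kind e ≡ required → orientation C e ≢ unused
      required-used e k with ∈-map⁻ proj₂ (S-required e k)
      ... | (u , _) , s∈ , refl = Leaves⇒used {orientation C} (∈⇒Leaves s∈)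
      leaving : ∀ v → ∃! _≡_ (Leaves (orientation C) v)
      leaving v with ∈-map⁻ proj₁ (S-covers v)
      ... | (_ , c) , s∈ , refl = c , ∈⇒Leaves s∈ , λ l → step-functional s∈ (Leaves-orientation⇒∈ C l)
      entering : ∀ v → ∃! _≡_ (Enters (orientation C) v)
      entering v with ∈-map⁻ proj₂ (∈-resp-↭ (↭-sym (map-proj₂-coverArcs C)) (S-covers v))
      ... | ((u , c) , _) , a∈ , refl =
          c
        , Leaves∧Links⇒Enters {orientation C} (∈⇒Leaves (arc⇒step a∈)) (arc⇒IsArc a∈)
        , λ ent → same-target a∈ (proj₂ (Enters⇒arc ent))
        where
        same-target : ∀ {u u′ c c′ v} → ((u , c) , v) ∈ Arcs → ((u′ , c′) , v) ∈ Arcs → c ≡ c′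
        same-target a∈ a∈′ = cong (λ a → proj₂ (proj₁ a)) (Unique-map⇒injectiveOn proj₂ targets-unique a∈ a∈′ refl)

  IsCycle⇒Unique-vertices : ∀ c → IsCycle G c → Unique (map proj₁ c)
  IsCycle⇒Unique-vertices (_ ∷ _) (_ , u , _) = u

  IsCycle⇒Unique-edges : ∀ c → IsCycle G c → Unique (map proj₂ c)
  IsCycle⇒Unique-edges (_ ∷ _) (_ , _ , u) = u

  chain-split : ∀ v₁ ss t ts → Chain G v₁ (ss ++ t ∷ ts) → Chain G (proj₁ t) ss × Chain G v₁ (t ∷ ts)
  chain-split v₁ []           t ts ch       = _ , ch
  chain-split v₁ (s ∷ [])     t ts (l , ch) = l , ch
  chain-split v₁ (s ∷ s′ ∷ ss) t ts (l , ch) with chain-split v₁ (s′ ∷ ss) t ts ch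
  ... | ch₁ , ch₂ = (l , ch₁) , ch₂

  chain-join : ∀ v₁ ss t ts → Chain G (proj₁ t) ss → Chain G v₁ (t ∷ ts) → Chain G v₁ (ss ++ t ∷ ts)
  chain-join v₁ []            t ts _         ch = ch
  chain-join v₁ (s ∷ [])      t ts l         ch = l , ch
  chain-join v₁ (s ∷ s′ ∷ ss) t ts (l , ch₁) ch = l , chain-join v₁ (s′ ∷ ss) t ts ch₁ ch

  IsCycle-rotate : ∀ d₁ s d₂ → IsCycle G (d₁ ++ s ∷ d₂) → Chain G (proj₁ s) (s ∷ d₂ ++ d₁)
  IsCycle-rotate []       s d₂ (ch , _) rewrite ++-identityʳ d₂ = ch
  IsCycle-rotate (h ∷ d₁) s d₂ (ch , _) with chain-split (proj₁ h) (h ∷ d₁) s d₂ ch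
  ... | ch₁ , ch₂ = chain-join (proj₁ s) (s ∷ d₂) h d₁ ch₂ ch₁

  Functional : List (Step G) → Set
  Functional T = ∀ {v c c′} → (v , c) ∈ T → (v , c′) ∈ T → c ≡ c′

  Unique-vertices⇒Functional : ∀ {T} → Unique (map proj₁ T) → Functional T
  Unique-vertices⇒Functional u p q = cong proj₂ (Unique-map⇒injectiveOn proj₁ u p q refl)

  -- Each next vertex is forced by Links, each next edge by T.
  chain-unique : ∀ v₁ s ss ss′ (T : List (Step G)) → Functional T → ss ⊆ T → ss′ ⊆ T
    → Chain G v₁ (s ∷ ss) → Chain G v₁ (s ∷ ss′) → v₁ ∉ map proj₁ ss → v₁ ∉ map proj₁ ss′ → ss ≡ ss′
  chain-unique v₁ s []       []         T fun ⊆T ⊆T′ ch ch′ _ _ = refl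
  chain-unique v₁ s []       (t′ ∷ ss′) T fun ⊆T ⊆T′ ch (l′ , _) _ v₁∉′ =
    ⊥-elim (v₁∉′ (here (Links-functional ch l′)))
  chain-unique v₁ s (t ∷ ss) []         T fun ⊆T ⊆T′ (l , _) ch′ v₁∉ _ =
    ⊥-elim (v₁∉ (here (Links-functional ch′ l)))
  chain-unique v₁ s (t ∷ ss) (t′ ∷ ss′) T fun ⊆T ⊆T′ (l , ch) (l′ , ch′) v₁∉ v₁∉′ with same-next
    where
    same-vertex : proj₁ t ≡ proj₁ t′
    same-vertex = Links-functional l l′
    same-next : t ≡ t′
    same-next = cong₂ _,_ same-vertex (fun (subst (λ v → (v , proj₂ t) ∈ T) same-vertex (⊆T (here refl))) (⊆T′ (here refl)))
  ... | refl =
    cong (t ∷_) (chain-unique v₁ t ss ss′ T fun (⊆T ∘ there) (⊆T′ ∘ there) ch ch′ (v₁∉ ∘ there) (v₁∉′ ∘ there))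

  sameCycle-through : ∀ {s ss} d₁ d₂ (T : List (Step G)) → Functional T → ss ⊆ T → d₁ ++ s ∷ d₂ ⊆ T
    → IsCycle G (s ∷ ss) → IsCycle G (d₁ ++ s ∷ d₂) → SameCycle G (s ∷ ss) (d₁ ++ s ∷ d₂)
  sameCycle-through {s} {ss} d₁ d₂ T fun ss⊆T d⊆T c-cycle d-cycle =
    (s ∷ d₂) , d₁ , cong (s ∷_) ss≡d₂d₁ , refl
    where
    rotation : d₁ ++ s ∷ d₂ ↭ s ∷ d₂ ++ d₁
    rotation = ↭.++-comm d₁ (s ∷ d₂)
    ss≡d₂d₁ : ss ≡ d₂ ++ d₁
    ss≡d₂d₁ = chain-unique (proj₁ s) s ss (d₂ ++ d₁) T fun ss⊆T
                (λ t∈ → d⊆T (∈-resp-↭ (↭-sym rotation) (there t∈)))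
                (proj₁ c-cycle) (IsCycle-rotate d₁ s d₂ d-cycle)
                (Unique[x∷xs]⇒x∉xs (IsCycle⇒Unique-vertices (s ∷ ss) c-cycle))
                (Unique[x∷xs]⇒x∉xs (Unique-resp-↭ (↭.map⁺ proj₁ rotation) (IsCycle⇒Unique-vertices _ d-cycle)))

  SameCycle⇒⊆ : ∀ {c d} → SameCycle G c d → c ⊆ d
  SameCycle⇒⊆ (xs , ys , refl , refl) s∈ with ∈-++⁻ xs s∈
  ... | inj₁ p = ∈-++⁺ʳ ys p
  ... | inj₂ p = ∈-++⁺ˡ p

  SameCycle-sym : ∀ {c d} → SameCycle G c d → SameCycle G d c
  SameCycle-sym (xs , ys , p , q) = ys , xs , q , p

  sameSteps⇒SameCover : ∀ C D → All (IsCycle G) C → All (IsCycle G) D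
    → Unique (map proj₁ (concat C)) → Unique (map proj₁ (concat D))
    → concat C ⊆ concat D → concat D ⊆ concat C
    → ∃[ C′ ] (Pointwise (SameCycle G) C C′ × C′ ↭ D)
  sameSteps⇒SameCover [] [] _ _ _ _ _ _ = [] , [] , refl
  sameSteps⇒SameCover [] ((s ∷ _) ∷ D) _ _ _ _ _ D⊆C with D⊆C (here refl)
  ... | ()
  sameSteps⇒SameCover [] ([] ∷ D) _ (() ∷ _) _ _ _ _
  sameSteps⇒SameCover ([] ∷ C) D (() ∷ _) _ _ _ _ _
  sameSteps⇒SameCover ((s ∷ ss) ∷ C) D (c-cycle ∷ C-cycles) D-cycles uC uD C⊆D D⊆C
    with ∈-concat⁻′ D (C⊆D (here refl))
  ... | d , s∈d , d∈D with ∈-∃++ s∈d | ∈⇒↭∷ d∈D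
  ...   | d₁ , d₂ , refl | D′ , D↭ =
    d ∷ proj₁ rest , c∼d ∷ proj₁ (proj₂ rest) , trans (prep d (proj₂ (proj₂ rest))) (↭-sym D↭)
    where
    c = s ∷ ss
    d-cycle = All.head (All-resp-↭ D↭ D-cycles)
    c∼d : SameCycle G c d
    c∼d = sameCycle-through d₁ d₂ (concat D) (Unique-vertices⇒Functional uD)
            (C⊆D ∘ ∈-++⁺ˡ ∘ there) (λ t∈ → ∈-concat⁺′ t∈ d∈D) c-cycle d-cycle
    uC′ : Unique (map proj₁ c ++ map proj₁ (concat C))
    uC′ = subst Unique (map-++ proj₁ c (concat C)) uC
    uD′ : Unique (map proj₁ d ++ map proj₁ (concat D′))
    uD′ = subst Unique (map-++ proj₁ d (concat D′)) (Unique-resp-↭ (↭.map⁺ proj₁ (↭-concat⁺ D↭)) uD)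
    C⊆D′ : concat C ⊆ concat D′
    C⊆D′ {t} t∈ with ∈-++⁻ d (∈-resp-↭ (↭-concat⁺ D↭) (C⊆D (∈-++⁺ʳ c t∈)))
    ... | inj₁ t∈d  = ⊥-elim (Unique-++⇒disjoint (map proj₁ c) uC′
                        (∈-map⁺ proj₁ (SameCycle⇒⊆ (SameCycle-sym c∼d) t∈d)) (∈-map⁺ proj₁ t∈))
    ... | inj₂ t∈D′ = t∈D′
    D′⊆C : concat D′ ⊆ concat C
    D′⊆C {t} t∈ with ∈-++⁻ c (D⊆C (∈-resp-↭ (↭-sym (↭-concat⁺ D↭)) (∈-++⁺ʳ d t∈)))
    ... | inj₁ t∈c  = ⊥-elim (Unique-++⇒disjoint (map proj₁ d) uD′
                        (∈-map⁺ proj₁ (SameCycle⇒⊆ c∼d t∈c)) (∈-map⁺ proj₁ t∈))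
    ... | inj₂ t∈C = t∈C
    rest = sameSteps⇒SameCover C D′ C-cycles (All.tail (All-resp-↭ D↭ D-cycles))
             (Unique-++⁻ʳ (map proj₁ c) uC′) (Unique-++⁻ʳ (map proj₁ d) uD′) C⊆D′ D′⊆C

  Pointwise-SameCycle⇒⊆ : ∀ {C C′} → Pointwise (SameCycle G) C C′ → concat C ⊆ concat C′
  Pointwise-SameCycle⇒⊆ [] ()
  Pointwise-SameCycle⇒⊆ {c ∷ C} {c′ ∷ C′} (c∼c′ ∷ C∼C′) s∈ with ∈-++⁻ c s∈
  ... | inj₁ p = ∈-++⁺ˡ (SameCycle⇒⊆ c∼c′ p)
  ... | inj₂ p = ∈-++⁺ʳ c′ (Pointwise-SameCycle⇒⊆ C∼C′ p)

  Pointwise-SameCycle-sym : ∀ {C C′} → Pointwise (SameCycle G) C C′ → Pointwise (SameCycle G) C′ C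
  Pointwise-SameCycle-sym []             = []
  Pointwise-SameCycle-sym (c∼c′ ∷ C∼C′) = SameCycle-sym c∼c′ ∷ Pointwise-SameCycle-sym C∼C′

  SameCover⇒⊆ : ∀ (X Y : CycleCoverR G) → SameCover G X Y → concat (proj₁ X) ⊆ concat (proj₁ Y)
  SameCover⇒⊆ _ _ (_ , C∼C′ , C′↭D) = ∈-resp-↭ (↭-concat⁺ C′↭D) ∘ Pointwise-SameCycle⇒⊆ C∼C′

  SameCover⇒⊇ : ∀ (X Y : CycleCoverR G) → SameCover G X Y → concat (proj₁ Y) ⊆ concat (proj₁ X)
  SameCover⇒⊇ _ _ (_ , C∼C′ , C′↭D) =
    Pointwise-SameCycle⇒⊆ (Pointwise-SameCycle-sym C∼C′) ∘ ∈-resp-↭ (↭-sym (↭-concat⁺ C′↭D))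

  ⊆⇒Leaves⇒Leaves : ∀ (X Y : CycleCoverR G) → concat (proj₁ X) ⊆ concat (proj₁ Y)
    → ∀ {v e} → Leaves (orientation (proj₁ X)) v e → Leaves (orientation (proj₁ Y)) v e
  ⊆⇒Leaves⇒Leaves (C , _) (D , D-cover) C⊆D = CoverSteps.∈⇒Leaves D D-cover ∘ C⊆D ∘ Leaves-orientation⇒∈ C

  orientation-cong : ∀ (X Y : CycleCoverR G) → SameCover G X Y
    → ∀ e → orientation (proj₁ X) e ≡ orientation (proj₁ Y) e
  orientation-cong X Y X∼Y = Leaves⇔⇒≗ {orientation (proj₁ X)} {orientation (proj₁ Y)}
    (⊆⇒Leaves⇒Leaves X Y (SameCover⇒⊆ X Y X∼Y)) (⊆⇒Leaves⇒Leaves Y X (SameCover⇒⊇ X Y X∼Y))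

  orientation-injective : ∀ (X Y : CycleCoverR G)
    → (∀ e → orientation (proj₁ X) e ≡ orientation (proj₁ Y) e) → SameCover G X Y
  orientation-injective (C , C-cover) (D , D-cover) C≗D =
    sameSteps⇒SameCover C D (proj₁ C-cover) (proj₁ D-cover) (proj₁ (proj₂ C-cover)) (proj₁ (proj₂ D-cover))
      (Leaves-orientation⇒∈ D ∘ Leaves-cong {orientation C} {orientation D} (C≗D _) ∘ CoverSteps.∈⇒Leaves C C-cover)
      (Leaves-orientation⇒∈ C ∘ Leaves-cong {orientation D} {orientation C} (sym (C≗D _)) ∘ CoverSteps.∈⇒Leaves D D-cover)

  Trail : Set
  Trail = Step G × List (Step G) × Fin nV

  trailSteps : Trail → List (Step G)
  trailSteps (s , ss , _) = s ∷ ss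

  source target : Trail → Fin nV
  source (s , _ , _) = proj₁ s
  target (_ , _ , t) = t

  IsTrail : Trail → Set
  IsTrail (s , ss , t) = Chain G t (s ∷ ss)

  allSteps : List Trail → List (Step G)
  allSteps P = concat (map trailSteps P)

  record Joinable (P : List Trail) : Set where
    field
      trails              : All IsTrail P
      vertices-unique     : Unique (map proj₁ (allSteps P))
      edges-unique        : Unique (map proj₂ (allSteps P))
      targets-unique      : Unique (map target P)
      targets-are-sources : All (λ p → target p ∈ map source P) P

  Joinable-close : ∀ {s ss P} → Joinable ((s , ss , proj₁ s) ∷ P) → IsCycle G (s ∷ ss) × Joinable P
  Joinable-close {s} {ss} {P} J =
      (All.head trails , Unique-++⁻ˡ (map proj₁ (s ∷ ss)) uV , Unique-++⁻ˡ (map proj₂ (s ∷ ss)) uE)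
    , record
    { trails              = All.tail trails
    ; vertices-unique     = Unique-++⁻ʳ (map proj₁ (s ∷ ss)) uV
    ; edges-unique        = Unique-++⁻ʳ (map proj₂ (s ∷ ss)) uE
    ; targets-unique      = AllPairs.tail targets-unique
    ; targets-are-sources = All.tabulate target∈sources
    }
    where
    open Joinable J
    uV = subst Unique (map-++ proj₁ (s ∷ ss) (allSteps P)) vertices-unique
    uE = subst Unique (map-++ proj₂ (s ∷ ss) (allSteps P)) edges-unique
    target∈sources : ∀ {p} → p ∈ P → target p ∈ map source P
    target∈sources {p} p∈ with All.lookup targets-are-sources (there p∈)
    ... | here eq  = ⊥-elim (Unique[x∷xs]⇒x∉xs targets-unique (subst (_∈ map target P) eq (∈-map⁺ target p∈)))
    ... | there q = q

  -- An open first trail is extended by the trail starting where it ends.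
  Joinable-join : ∀ {s ss t P} → t ≢ proj₁ s → Joinable ((s , ss , t) ∷ P)
    → ∃[ P′ ] (length P′ ≡ length P × Joinable P′ × allSteps ((s , ss , t) ∷ P) ↭ allSteps P′)
  Joinable-join {s} {ss} {t} {P} t≢s J = p′ ∷ P″ , sym (↭.↭-length P↭) , J′ , steps↭
    where
    open Joinable J
    t∈sources : t ∈ map source P
    t∈sources with All.head targets-are-sources
    ... | here eq  = ⊥-elim (t≢s eq)
    ... | there q = q
    next = ∈-map⁻ source t∈sources
    q = proj₁ next
    P″ = proj₁ (∈⇒↭∷ (proj₁ (proj₂ next)))
    P↭ : P ↭ q ∷ P″
    P↭ = proj₂ (∈⇒↭∷ (proj₁ (proj₂ next)))
    s′ = proj₁ q
    ss′ = proj₁ (proj₂ q)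
    t′ = proj₂ (proj₂ q)
    t≡s′ : t ≡ proj₁ s′
    t≡s′ = proj₂ (proj₂ next)
    p′ : Trail
    p′ = s , ss ++ s′ ∷ ss′ , t′
    steps↭ : allSteps ((s , ss , t) ∷ P) ↭ allSteps (p′ ∷ P″)
    steps↭ = trans (↭.++⁺ˡ (s ∷ ss) (↭-concat⁺ (↭.map⁺ trailSteps P↭)))
                   (↭-reflexive (sym (++-assoc (s ∷ ss) (s′ ∷ ss′) (allSteps P″))))
    targets↭ : map target ((s , ss , t) ∷ P) ↭ t ∷ t′ ∷ map target P″
    targets↭ = prep t (↭.map⁺ target P↭)
    sources↭ : map source ((s , ss , t) ∷ P) ↭ proj₁ s ∷ proj₁ s′ ∷ map source P″
    sources↭ = prep (proj₁ s) (↭.map⁺ source P↭)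
    targets-unique′ : Unique (t ∷ t′ ∷ map target P″)
    targets-unique′ = Unique-resp-↭ targets↭ targets-unique
    target∈sources : ∀ {p} → p ∈ (s , ss , t) ∷ P → target p ≢ t → target p ∈ map source (p′ ∷ P″)
    target∈sources {p} p∈ ≢t with ∈-resp-↭ sources↭ (All.lookup targets-are-sources p∈)
    ... | here eq          = here eq
    ... | there (here eq)  = ⊥-elim (≢t (≡-trans eq (sym t≡s′)))
    ... | there (there z) = there z
    J′ : Joinable (p′ ∷ P″)
    J′ = record
      { trails              = chain-join t′ (s ∷ ss) s′ ss′ (subst (λ z → Chain G z (s ∷ ss)) t≡s′ (All.head trails))
                                         (All.lookup trails (there (proj₁ (proj₂ next))))
                            ∷ All.tail (All-resp-↭ P↭ (All.tail trails))
      ; vertices-unique     = Unique-resp-↭ (↭.map⁺ proj₁ steps↭) vertices-unique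
      ; edges-unique        = Unique-resp-↭ (↭.map⁺ proj₂ steps↭) edges-unique
      ; targets-unique      = AllPairs.tail targets-unique′
      ; targets-are-sources =
            target∈sources (there (∈-resp-↭ (↭-sym P↭) (here refl)))
                           (λ eq → Unique[x∷xs]⇒x∉xs targets-unique′ (here (sym eq)))
          ∷ All.tabulate (λ {p} p∈ → target∈sources (there (∈-resp-↭ (↭-sym P↭) (there p∈)))
              (λ eq → Unique[x∷xs]⇒x∉xs targets-unique′ (there (subst (_∈ map target P″) eq (∈-map⁺ target p∈)))))
      }

  Joinable⇒cycles : ∀ n P → length P ≡ n → Joinable P → ∃[ C ] (All (IsCycle G) C × concat C ↭ allSteps P)
  Joinable⇒cycles zero    []                 _   _ = [] , [] , refl
  Joinable⇒cycles (suc n) ((s , ss , t) ∷ P) len J with t Fin.≟ proj₁ s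
  ... | yes refl with Joinable-close J
  ...   | cycle , J′ with Joinable⇒cycles n P (cong Nat.pred len) J′
  ...     | C , cycles , C↭ = (s ∷ ss) ∷ C , cycle ∷ cycles , ↭.++⁺ˡ (s ∷ ss) C↭
  Joinable⇒cycles (suc n) ((s , ss , t) ∷ P) len J | no t≢s with Joinable-join t≢s J
  ... | P′ , len′ , J′ , steps↭ with Joinable⇒cycles n P′ (≡-trans len′ (cong Nat.pred len)) J′
  ...   | C , cycles , C↭ = C , cycles , trans C↭ (↭-sym steps↭)

  module _ {x : Fin nE → EdgeUse} (ox : IsCoverOrientation x) where
    open IsCoverOrientation ox

    private
      out : Fin nV → Fin nE
      out v = proj₁ (leaving v)

      out-leaves : ∀ v → Leaves x v (out v)
      out-leaves v = proj₁ (proj₂ (leaving v))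

      entering-unique : ∀ v {e e′} → Enters x v e → Enters x v e′ → e ≡ e′
      entering-unique v ent ent′ = ≡-trans (sym (proj₂ (proj₂ (entering v)) ent)) (proj₂ (proj₂ (entering v)) ent′)

      successor : ∀ v → ∃[ w ] Links G v (out v) w
      successor v with out-leaves v
      ... | inj₁ (t , _)  = hd (out v) , subst (λ u → Links G u (out v) (hd (out v))) t (Links-forward (out v))
      ... | inj₂ (h , xb) = tl (out v) , subst (λ u → Links G u (out v) (tl (out v))) h
                                           (Links-backward (out v) (λ k → proj₁ (kindCompatible (out v)) k xb))

      next : Fin nV → Fin nV
      next v = proj₁ (successor v)

      out-injective : ∀ {v v′} → out v ≡ out v′ → v ≡ v′
      out-injective {v} {v′} eq = Leaves-injective {x} (out-leaves v) (subst (Leaves x v′) (sym eq) (out-leaves v′))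

      next-injective : ∀ {v v′} → next v ≡ next v′ → v ≡ v′
      next-injective {v} {v′} eq = out-injective (entering-unique (next v′)
        (subst (λ w → Enters x w (out v)) eq (Leaves∧Links⇒Enters {x} (out-leaves v) (proj₂ (successor v))))
        (Leaves∧Links⇒Enters {x} (out-leaves v′) (proj₂ (successor v′))))

      leavingStep : Fin nV → Step G
      leavingStep v = v , out v

      singleTrail : Fin nV → Trail
      singleTrail v = leavingStep v , [] , next v

      S₀ : List (Step G)
      S₀ = map leavingStep (allFin nV)

      P₀ : List Trail
      P₀ = map singleTrail (allFin nV)

      allSteps-P₀ : allSteps P₀ ≡ S₀
      allSteps-P₀ = ≡-trans (cong concat (sym (map-∘ (allFin nV)))) (concat-map-[_] (allFin nV))
        where
        concat-map-[_] : ∀ vs → concat (map (λ v → leavingStep v ∷ []) vs) ≡ map leavingStep vs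
        concat-map-[_] []       = refl
        concat-map-[_] (v ∷ vs) = cong (leavingStep v ∷_) (concat-map-[_] vs)

      map-allFin-unique : ∀ {B : Set} (f : Fin nV → B) → (∀ {v v′} → f v ≡ f v′ → v ≡ v′) → Unique (map f (allFin nV))
      map-allFin-unique f inj = Uniqueₚ.map⁺ inj (Uniqueₚ.allFin⁺ nV)

      ∈S₀⇔Leaves : ∀ {v e} → ((v , e) ∈ S₀ → Leaves x v e) × (Leaves x v e → (v , e) ∈ S₀)
      ∈S₀⇔Leaves {v} {e} = to , from
        where
        to : (v , e) ∈ S₀ → Leaves x v e
        to p with ∈-map⁻ leavingStep p
        ... | _ , _ , refl = out-leaves v
        from : Leaves x v e → (v , e) ∈ S₀
        from l = subst (λ e′ → (v , e′) ∈ S₀) (proj₂ (proj₂ (leaving v)) l) (∈-map⁺ leavingStep (∈-allFin v))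

      P₀-joinable : Joinable P₀
      P₀-joinable = record
        { trails              = All.tabulate λ p∈ → trail p∈
        ; vertices-unique     = subst (λ T → Unique (map proj₁ T)) (sym allSteps-P₀)
                                  (subst Unique (map-∘ (allFin nV)) (map-allFin-unique (λ v → v) (λ eq → eq)))
        ; edges-unique        = subst (λ T → Unique (map proj₂ T)) (sym allSteps-P₀)
                                  (subst Unique (map-∘ (allFin nV)) (map-allFin-unique out out-injective))
        ; targets-unique      = subst Unique (map-∘ (allFin nV)) (map-allFin-unique next next-injective)
        ; targets-are-sources = All.tabulate λ p∈ → target∈sources p∈
        }
        where
        trail : ∀ {p} → p ∈ P₀ → IsTrail p
        trail p∈ with ∈-map⁻ singleTrail p∈
        ... | v , _ , refl = proj₂ (successor v)
        target∈sources : ∀ {p} → p ∈ P₀ → target p ∈ map source P₀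
        target∈sources p∈ with ∈-map⁻ singleTrail p∈
        ... | v , _ , refl = ∈-map⁺ source (∈-map⁺ singleTrail (∈-allFin (next v)))

    cover-of-orientation : Σ (CycleCoverR G) λ X → ∀ e → orientation (proj₁ X) e ≡ x e
    cover-of-orientation = (C₀ , C₀-cover) , Leaves⇔⇒≗ {orientation C₀} {x}
      (λ l → proj₁ ∈S₀⇔Leaves (∈-resp-↭ C₀↭S₀ (Leaves-orientation⇒∈ C₀ l)))
      (λ l → CoverSteps.∈⇒Leaves C₀ C₀-cover (∈-resp-↭ (↭-sym C₀↭S₀) (proj₂ ∈S₀⇔Leaves l)))
      where
      cycles = Joinable⇒cycles (length P₀) P₀ refl P₀-joinable
      C₀ = proj₁ cycles
      C₀↭S₀ : concat C₀ ↭ S₀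
      C₀↭S₀ = subst (concat C₀ ↭_) allSteps-P₀ (proj₂ (proj₂ cycles))
      C₀-cover : IsCycleCoverR G C₀
      C₀-cover = proj₁ (proj₂ cycles)
               , Unique-resp-↭ (↭.map⁺ proj₁ (↭-sym C₀↭S₀))
                   (subst Unique (map-∘ (allFin nV)) (map-allFin-unique (λ v → v) (λ eq → eq)))
               , (λ v → ∈-map⁺ proj₁ (∈-resp-↭ (↭-sym C₀↭S₀) (proj₂ ∈S₀⇔Leaves (out-leaves v))))
               , required∈
        where
        required∈ : ∀ e → kind e ≡ required → e ∈ map proj₂ (concat C₀)
        required∈ e k with x e in xe
        ... | forward  = ∈-map⁺ proj₂ (∈-resp-↭ (↭-sym C₀↭S₀) (proj₂ ∈S₀⇔Leaves (Leaves-forward {x} e xe)))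
        ... | backward = ∈-map⁺ proj₂ (∈-resp-↭ (↭-sym C₀↭S₀) (proj₂ ∈S₀⇔Leaves (Leaves-backward {x} e xe)))
        ... | unused   = ⊥-elim (proj₂ (kindCompatible e) k xe)

-- Flows and orientations

module _ (G : MixedGraph) where
  open MixedGraph G

  Incident : Fin nV → Fin nE → Set
  Incident v e = tl e ≡ v ⊎ hd e ≡ v

  incident? : ∀ v e → Dec (Incident v e)
  incident? v e = (tl e Fin.≟ v) ⊎-dec (hd e Fin.≟ v)

  incident : Fin nV → List (Fin nE)
  incident v = filter (incident? v) (allFin nE)

  -- The use of e as seen from v, forward meaning towards v.
  useToward : (Fin nE → EdgeUse) → Fin nV → Fin nE → EdgeUse
  useToward x v e with tl e Fin.≟ v
  ... | yes _ = reverse (x e)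
  ... | no _  = x e

  Balanced : (Fin nE → EdgeUse) → Set
  Balanced x = ∀ v → sum (map (headward ∘ useToward x v) (incident v)) ≡ length (incident v)

-- aim o o′ d: the use, seen from end o′, of a segment traversed from end o
-- along an edge of use d.
aim : Bool → Bool → EdgeUse → EdgeUse
aim false false = reverse
aim true  true  = reverse
aim false true  = λ d → d
aim true  false = λ d → d

aim-not : ∀ o d → aim o (not o) d ≡ d
aim-not false d = refl
aim-not true  d = refl

aim-same : ∀ o d → aim o o d ≡ reverse d
aim-same false d = refl
aim-same true  d = refl

module _ {G : MixedGraph} {a b : ℕ} (emb : GridEmbedding G a b) where
  open MixedGraph G
  open GridEmbedding emb

  Used : Seg a b → Fin nE → Bool → Set
  Used s e o = endpoints s o ∈ pairs (path e)

  Unused : Seg a b → Set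
  Unused s = ∀ e o → ¬ Used s e o

  Used-unique : ∀ {s e e′ o o′} → Used s e o → Used s e′ o′ → e ≡ e′ × o ≡ o′
  Used-unique {o = false} {false} u u′ = segDisj _ _ _ _ u (inj₁ u′) , refl
  Used-unique {o = true}  {true}  u u′ = segDisj _ _ _ _ u (inj₁ u′) , refl
  Used-unique {e = e} {e′} {false} {true} u u′ with segDisj e e′ _ _ u (inj₂ u′)
  ... | refl = ⊥-elim (pairs-asym (pathSimple e) u u′)
  Used-unique {e = e} {e′} {true} {false} u u′ with segDisj e e′ _ _ u (inj₂ u′)
  ... | refl = ⊥-elim (pairs-asym (pathSimple e) u u′)

  owner : ∀ s → (∃[ e ] ∃[ o ] Used s e o) ⊎ Unused s
  owner s with Finₚ.any? (λ e → used? e false ⊎-dec used? e true)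
    where
    used? : ∀ e o → Dec (Used s e o)
    used? e o = Membership._∈?_ (≡-dec _≟P_ _≟P_) (endpoints s o) (pairs (path e))
  ... | yes (e , inj₁ u) = inj₁ (e , false , u)
  ... | yes (e , inj₂ u) = inj₁ (e , true , u)
  ... | no none = inj₂ λ { e false u → none (e , inj₁ u) ; e true u → none (e , inj₂ u) }

  segmentOf : ∀ {e p q} → (p , q) ∈ pairs (path e) → ∃[ s ] ∃[ o ] (endpoints s o ≡ (p , q) × Used s e o)
  segmentOf {e} pq∈ with All.lookup (pathAdj e) pq∈
  ... | s , o , refl , refl = s , o , refl , pq∈

  firstSegment : ∀ e → ∃[ s ] ∃[ o ] (end s o ≡ pos (tl e) × Used s e o)
  firstSegment e with segmentOf (proj₂ (∈⇒successor {z = pos (hd e)} (here {xs = interior e} refl)))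
  ... | s , o , eq , u = s , o , cong proj₁ eq , u

  lastSegment : ∀ e → ∃[ s ] ∃[ o ] (end s (not o) ≡ pos (hd e) × Used s e o)
  lastSegment e with segmentOf (proj₂ (∈⇒predecessor {x = pos (tl e)} (∈-++⁺ʳ (interior e) (here refl))))
  ... | s , o , eq , u = s , o , cong proj₂ eq , u

  Fixed : Flow a b → Set
  Fixed g = ∀ s → Unused s → g s false ≡ 1 × g s true ≡ 1

  Agrees : Flow a b → (Fin nE → EdgeUse) → Set
  Agrees g x = ∀ {s e o} → Used s e o → g s (not o) ≡ headward (x e) × g s o ≡ headward (reverse (x e))

  flowOf : (Fin nE → EdgeUse) → Flow a b
  flowOf x s = flowFrom (owner s)
    where
    flowFrom : (∃[ e ] ∃[ o ] Used s e o) ⊎ Unused s → Bool → ℕ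
    flowFrom (inj₁ (e , o , _)) o′ = headward (aim o o′ (x e))
    flowFrom (inj₂ _)           _  = 1

  flowOf-fixed : ∀ x → Fixed (flowOf x)
  flowOf-fixed x s unused-s with owner s
  ... | inj₁ (e , o , u) = ⊥-elim (unused-s e o u)
  ... | inj₂ _           = refl , refl

  flowOf-agrees : ∀ x → Agrees (flowOf x) x
  flowOf-agrees x {s} {e} {o} u with owner s
  ... | inj₂ unused-s = ⊥-elim (unused-s e o u)
  ... | inj₁ (e′ , o′ , u′) with Used-unique u u′
  ...   | refl , refl = cong headward (aim-not o (x e)) , cong headward (aim-same o (x e))

  flowOf-cong : ∀ {x y} → (∀ e → x e ≡ y e) → ∀ s o → flowOf x s o ≡ flowOf y s o
  flowOf-cong x≗y s o with owner s
  ... | inj₁ (e , _ , _) rewrite x≗y e = refl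
  ... | inj₂ _           = refl

  flowOf-supply : ∀ x s → flowOf x s false + flowOf x s true ≡ 2
  flowOf-supply x s with owner s
  ... | inj₁ (e , false , _) = ≡-trans (+-comm (headward (reverse (x e))) _) (headward-reverse (x e))
  ... | inj₁ (e , true , _)  = headward-reverse (x e)
  ... | inj₂ _               = refl

  flowOf-injective : ∀ {x y} → (∀ s o → flowOf x s o ≡ flowOf y s o) → ∀ e → x e ≡ y e
  flowOf-injective {x} {y} fx≗fy e with firstSegment e
  ... | s , o , _ , u = headward-injective (begin
    headward (x e)       ≡⟨ sym (proj₁ (flowOf-agrees x u)) ⟩
    flowOf x s (not o)   ≡⟨ fx≗fy s (not o) ⟩
    flowOf y s (not o)   ≡⟨ proj₁ (flowOf-agrees y u) ⟩
    headward (y e)       ∎)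
    where open ≡-Reasoning

  Agrees⇒≗flowOf : ∀ {g x} → Agrees g x → Fixed g → ∀ s o → g s o ≡ flowOf x s o
  Agrees⇒≗flowOf {g} {x} agrees fixed s o with owner s
  ... | inj₂ unused-s = fixed-value o
    where
    fixed-value : ∀ o → g s o ≡ 1
    fixed-value false = proj₁ (fixed s unused-s)
    fixed-value true  = proj₂ (fixed s unused-s)
  ... | inj₁ (e , o₀ , u) = agreed o₀ o u
    where
    agreed : ∀ o₀ o → Used s e o₀ → g s o ≡ headward (aim o₀ o (x e))
    agreed false false u = proj₂ (agrees u)
    agreed true  true  u = proj₂ (agrees u)
    agreed false true  u = proj₁ (agrees u)
    agreed true  false u = proj₁ (agrees u)

  Touches : Seg a b → Point a b → Set
  Touches s p = end s false ≡ p ⊎ end s true ≡ p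

  Touches⇒end : ∀ {s p} o → Touches s p → end s o ≡ p ⊎ end s (not o) ≡ p
  Touches⇒end false t = t
  Touches⇒end true (inj₁ t) = inj₂ t
  Touches⇒end true (inj₂ t) = inj₁ t

  ∈-path⁻ : ∀ {e q} → q ∈ path e → q ≡ pos (tl e) ⊎ q ∈ interior e ⊎ q ≡ pos (hd e)
  ∈-path⁻ (here eq) = inj₁ eq
  ∈-path⁻ {e} (there q∈) with ∈-++⁻ (interior e) q∈
  ... | inj₁ q∈I          = inj₂ (inj₁ q∈I)
  ... | inj₂ (here eq)    = inj₂ (inj₂ eq)

  Used∧Touches⇒∈path : ∀ {s e o p} → Used s e o → Touches s p → p ∈ path e
  Used∧Touches⇒∈path {o = o} u t with Touches⇒end o t
  ... | inj₁ refl = proj₁ (∈-pairs⁻ u)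
  ... | inj₂ refl = proj₂ (∈-pairs⁻ u)

  contribution : Flow a b → Point a b → Seg a b → ℕ
  contribution g p s = (if does (end s false ≟P p) then g s false else 0)
                     + (if does (end s true ≟P p) then g s true else 0)

  contribution-at : ∀ g {p s} o → end s o ≡ p → contribution g p s ≡ g s o
  contribution-at g {p} {s} false eq with end s false ≟P p | end s true ≟P p
  ... | yes _ | yes eq′ = ⊥-elim (end-false≢end-true s (≡-trans eq (sym eq′)))
  ... | yes _ | no _    = +-identityʳ (g s false)
  ... | no ne | _       = ⊥-elim (ne eq)
  contribution-at g {p} {s} true eq with end s false ≟P p | end s true ≟P p
  ... | yes eq′ | _     = ⊥-elim (end-false≢end-true s (≡-trans eq′ (sym eq)))
  ... | no _    | yes _ = refl
  ... | no _    | no ne = ⊥-elim (ne eq)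

  contribution-away : ∀ g {p s} → ¬ Touches s p → contribution g p s ≡ 0
  contribution-away g {p} {s} away with end s false ≟P p | end s true ≟P p
  ... | yes eq | _      = ⊥-elim (away (inj₁ eq))
  ... | no _   | yes eq = ⊥-elim (away (inj₂ eq))
  ... | no _   | no _   = refl

  -- The sink condition at p only involves the used segments touching p,
  -- listed in L together with the side facing p: all others carry 1 towards p
  -- or nothing at all.
  balance : ∀ {g} → Fixed g → ∀ p (L : List (Seg a b × Bool))
    → Unique (map proj₁ L) → All (λ so → end (proj₁ so) (proj₂ so) ≡ p) L
    → (∀ {s e o} → Used s e o → Touches s p → s ∈ map proj₁ L)
    → inflow emb g p + length L ≡ degH p + sum (map (λ so → g (proj₁ so) (proj₂ so)) L)
  balance {g} fixed p L uL at-p complete = begin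
    inflow emb g p + length L                 ≡⟨ cong (inflow emb g p +_) (≡-trans (sym (length-as-sum L)) (sym (sum-at one at-p))) ⟩
    sum (map φ U) + sum (map ψ (map proj₁ L)) ≡⟨ sum-map-exchange φ ψ U (map proj₁ L) allSegs-unique uL
                                                                     (λ _ → ∈-allSegs _) off-L ⟩
    sum (map ψ U) + sum (map φ (map proj₁ L)) ≡⟨ cong (degH p +_) (sum-at g at-p) ⟩
    degH p + sum (map (λ so → g (proj₁ so) (proj₂ so)) L) ∎
    where
    open ≡-Reasoning
    one : Flow a b
    one _ _ = 1
    U = allSegs a b
    φ = contribution g p
    ψ = contribution one p
    sum-at : ∀ h {L} → All (λ so → end (proj₁ so) (proj₂ so) ≡ p) L
           → sum (map (contribution h p) (map proj₁ L)) ≡ sum (map (λ so → h (proj₁ so) (proj₂ so)) L)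
    sum-at h []                   = refl
    sum-at h {(s , o) ∷ L} (eq ∷ eqs) = cong₂ _+_ (contribution-at h o eq) (sum-at h eqs)
    length-as-sum : ∀ (L : List (Seg a b × Bool)) → sum (map (λ _ → 1) L) ≡ length L
    length-as-sum []      = refl
    length-as-sum (_ ∷ L) = cong suc (length-as-sum L)
    off-L : ∀ {s} → s ∈ U → s ∉ map proj₁ L → φ s ≡ ψ s
    off-L {s} _ s∉L with owner s
    ... | inj₁ (e , o , u) = ≡-trans (contribution-away g away) (sym (contribution-away one away))
      where away = λ t → s∉L (complete u t)
    ... | inj₂ unused-s with fixed s unused-s
    ...   | g₀ , g₁ rewrite g₀ | g₁ = refl

  Used⇒start≢head : ∀ {s e o} → Used s e o → end s o ≢ pos (hd e)
  Used⇒start≢head {s} {e} {o} u eq =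
    pairs-last-noSuccessor (pos (tl e) ∷ interior e) (pathSimple e) (subst (λ p → (p , end s (not o)) ∈ pairs (path e)) eq u)

  Used⇒finish≢tail : ∀ {s e o} → Used s e o → end s (not o) ≢ pos (tl e)
  Used⇒finish≢tail {s} {e} {o} u eq =
    pairs-head-noPredecessor (pathSimple e) (subst (λ p → (end s o , p) ∈ pairs (path e)) eq u)

  same-start⇒same-segment : ∀ {s s′ e o o′} → Used s e o → Used s′ e o′ → end s o ≡ end s′ o′ → s ≡ s′ × o ≡ o′
  same-start⇒same-segment {s} {s′} {e} {o} {o′} u u′ eq = endpoints-injective (cong₂ _,_ eq
    (pairs-successor-unique (pathSimple e) (subst (λ p → (p , end s (not o)) ∈ pairs (path e)) eq u) u′))

  same-finish⇒same-segment : ∀ {s s′ e o o′} → Used s e o → Used s′ e o′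
    → end s (not o) ≡ end s′ (not o′) → s ≡ s′ × o ≡ o′
  same-finish⇒same-segment {s} {s′} {e} {o} {o′} u u′ eq = endpoints-injective (cong₂ _,_
    (pairs-predecessor-unique (pathSimple e) (subst (λ p → (end s o , p) ∈ pairs (path e)) eq u) u′) eq)

  -- The segment of e at its end v, with the side facing v.
  endOf : Fin nV → Fin nE → Seg a b × Bool
  endOf v e with tl e Fin.≟ v
  ... | yes _ = proj₁ (firstSegment e) , proj₁ (proj₂ (firstSegment e))
  ... | no _  = proj₁ (lastSegment e) , not (proj₁ (proj₂ (lastSegment e)))

  endOf-agrees : ∀ {g x} → Agrees g x → ∀ v e → g (proj₁ (endOf v e)) (proj₂ (endOf v e)) ≡ headward (useToward G x v e)
  endOf-agrees agrees v e with tl e Fin.≟ v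
  ... | yes _ = proj₂ (agrees (proj₂ (proj₂ (proj₂ (firstSegment e)))))
  ... | no _  = proj₁ (agrees (proj₂ (proj₂ (proj₂ (lastSegment e)))))

  endOf-at : ∀ {v e} → Incident G v e → end (proj₁ (endOf v e)) (proj₂ (endOf v e)) ≡ pos v
  endOf-at {v} {e} inc with tl e Fin.≟ v | inc
  ... | yes t  | _      = ≡-trans (proj₁ (proj₂ (proj₂ (firstSegment e)))) (cong pos t)
  ... | no ¬t  | inj₁ t = ⊥-elim (¬t t)
  ... | no _   | inj₂ h = ≡-trans (proj₁ (proj₂ (proj₂ (lastSegment e)))) (cong pos h)

  endOf-used : ∀ v e → ∃[ o ] Used (proj₁ (endOf v e)) e o
  endOf-used v e with tl e Fin.≟ v
  ... | yes _ = proj₁ (proj₂ (firstSegment e)) , proj₂ (proj₂ (proj₂ (firstSegment e)))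
  ... | no _  = proj₁ (proj₂ (lastSegment e)) , proj₂ (proj₂ (proj₂ (lastSegment e)))

  endOf-complete : ∀ {s e o v} → Used s e o → Touches s (pos v) → Incident G v e × s ≡ proj₁ (endOf v e)
  endOf-complete {s} {e} {o} {v} u t with ∈-path⁻ (Used∧Touches⇒∈path u t)
  ... | inj₂ (inj₁ v∈I) = ⊥-elim (intNoVert e v v∈I)
  ... | inj₁ v-tl = inj₁ (sym v≡tl) , at-tail (Touches⇒end o t)
    where
    v≡tl = posInj _ _ v-tl
    first = firstSegment e
    at-tail : end s o ≡ pos v ⊎ end s (not o) ≡ pos v → s ≡ proj₁ (endOf v e)
    at-tail t′ with tl e Fin.≟ v
    ... | no ¬t = ⊥-elim (¬t (sym v≡tl))
    ... | yes _ with t′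
    ...   | inj₁ at-start = proj₁ (same-start⇒same-segment u (proj₂ (proj₂ (proj₂ first)))
                              (≡-trans (≡-trans at-start v-tl) (sym (proj₁ (proj₂ (proj₂ first))))))
    ...   | inj₂ at-finish = ⊥-elim (Used⇒finish≢tail u (≡-trans at-finish v-tl))
  ... | inj₂ (inj₂ v-hd) = inj₂ (sym v≡hd) , at-head (Touches⇒end o t)
    where
    v≡hd = posInj _ _ v-hd
    last = lastSegment e
    at-head : end s o ≡ pos v ⊎ end s (not o) ≡ pos v → s ≡ proj₁ (endOf v e)
    at-head t′ with tl e Fin.≟ v
    ... | yes tl≡v = ⊥-elim (noLoop e (≡-trans tl≡v v≡hd))
    ... | no _ with t′
    ...   | inj₁ at-start  = ⊥-elim (Used⇒start≢head u (≡-trans at-start v-hd))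
    ...   | inj₂ at-finish = proj₁ (same-finish⇒same-segment u (proj₂ (proj₂ (proj₂ last)))
                              (≡-trans (≡-trans at-finish v-hd) (sym (proj₁ (proj₂ (proj₂ last))))))

  vertex-balance : ∀ {g} → Fixed g → ∀ v → inflow emb g (pos v) + length (incident G v)
    ≡ degH (pos v) + sum (map (λ e → g (proj₁ (endOf v e)) (proj₂ (endOf v e))) (incident G v))
  vertex-balance {g} fixed v =
    subst₂ (λ l r → inflow emb g (pos v) + l ≡ degH (pos v) + r) (length-map (endOf v) I) (cong sum (sym (map-∘ I)))
           (balance {g} fixed (pos v) (map (endOf v) I) unique at complete)
    where
    I = incident G v
    same-edge : ∀ {e e′} → e ∈ I → e′ ∈ I → proj₁ (endOf v e) ≡ proj₁ (endOf v e′) → e ≡ e′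
    same-edge {e} {e′} _ _ eq =
      proj₁ (Used-unique (subst (λ s → Used s e (proj₁ (endOf-used v e))) eq (proj₂ (endOf-used v e))) (proj₂ (endOf-used v e′)))
    unique : Unique (map proj₁ (map (endOf v) I))
    unique = subst Unique (map-∘ I)
      (Unique-map⁺-injectiveOn (proj₁ ∘ endOf v) (Uniqueₚ.filter⁺ (incident? G v) (Uniqueₚ.allFin⁺ nE)) same-edge)
    at : All (λ so → end (proj₁ so) (proj₂ so) ≡ pos v) (map (endOf v) I)
    at = Allₚ.map⁺ (All.tabulate (λ e∈ → endOf-at (proj₂ (∈-filter⁻ (incident? G v) {xs = allFin nE} e∈))))
    complete : ∀ {s e o} → Used s e o → Touches s (pos v) → s ∈ map proj₁ (map (endOf v) I)
    complete {s} {e} u t with endOf-complete u t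
    ... | inc , refl = ∈-map⁺ proj₁ (∈-map⁺ (endOf v) (∈-filter⁺ (incident? G v) (∈-allFin e) inc))

  vertex-sink⇔Balanced : ∀ {g x} → Agrees g x → Fixed g → ∀ v
    → (inflow emb g (pos v) ≡ degH (pos v) → sum (map (headward ∘ useToward G x v) (incident G v)) ≡ length (incident G v))
    × (sum (map (headward ∘ useToward G x v) (incident G v)) ≡ length (incident G v) → inflow emb g (pos v) ≡ degH (pos v))
  vertex-sink⇔Balanced {g} {x} agrees fixed v =
      (λ sink → sym (+-cancelˡ-≡ (degH (pos v)) _ _ (≡-trans (cong (_+ length I) (sym sink)) balanced)))
    , (λ bal → +-cancelʳ-≡ (length I) _ _ (≡-trans balanced (cong (degH (pos v) +_) bal)))
    where
    I = incident G v
    balanced : inflow emb g (pos v) + length I ≡ degH (pos v) + sum (map (headward ∘ useToward G x v) I)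
    balanced = ≡-trans (vertex-balance {g} fixed v) (cong (λ l → degH (pos v) + sum l) (map-cong (endOf-agrees agrees v) I))

  interior-balance : ∀ {g} → Fixed g → ∀ {e p s₁ o₁ s₂ o₂} → p ∈ interior e
    → Used s₁ e o₁ → end s₁ (not o₁) ≡ p → Used s₂ e o₂ → end s₂ o₂ ≡ p
    → inflow emb g p + 2 ≡ degH p + (g s₁ (not o₁) + (g s₂ o₂ + 0))
  interior-balance {g} fixed {e} {p} {s₁} {o₁} {s₂} {o₂} p∈ u₁ at₁ u₂ at₂ =
    balance {g} fixed p ((s₁ , not o₁) ∷ (s₂ , o₂) ∷ []) ((s₁≢s₂ ∷ []) ∷ [] ∷ []) (at₁ ∷ at₂ ∷ []) complete
    where
    s₁≢s₂ : s₁ ≢ s₂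
    s₁≢s₂ refl with Used-unique u₁ u₂
    ... | _ , refl = end≢end-not s₁ o₁ (≡-trans at₂ (sym at₁))
    complete : ∀ {s e′ o} → Used s e′ o → Touches s p → s ∈ s₁ ∷ s₂ ∷ []
    complete {s} {e′} {o} u t with intDisj e e′ p p∈ (Used∧Touches⇒∈path u t)
    ... | refl with Touches⇒end o t
    ...   | inj₁ at-start  = there (here (proj₁ (same-start⇒same-segment u u₂ (≡-trans at-start (sym at₂)))))
    ...   | inj₂ at-finish = here (proj₁ (same-finish⇒same-segment u u₁ (≡-trans at-finish (sym at₁))))

  interior-sink : ∀ {g} → Fixed g → ∀ {e p} → p ∈ interior e
    → (∀ {s₁ o₁ s₂ o₂} → Used s₁ e o₁ → Used s₂ e o₂ → g s₁ (not o₁) + g s₂ o₂ ≡ 2)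
    → inflow emb g p ≡ degH p
  interior-sink {g} fixed {e} {p} p∈ passes
    with segmentOf (proj₂ (∈⇒predecessor {x = pos (tl e)} (∈-++⁺ˡ {ys = pos (hd e) ∷ []} p∈)))
       | segmentOf (proj₂ (∈⇒successor {z = pos (hd e)} (there {x = pos (tl e)} p∈)))
  ... | s₁ , o₁ , eq₁ , u₁ | s₂ , o₂ , eq₂ , u₂ =
    +-cancelʳ-≡ 2 _ _ (begin
      inflow emb g p + 2                        ≡⟨ interior-balance {g} fixed p∈ u₁ (cong proj₂ eq₁) u₂ (cong proj₁ eq₂) ⟩
      degH p + (g s₁ (not o₁) + (g s₂ o₂ + 0)) ≡⟨ cong (λ n → degH p + (g s₁ (not o₁) + n)) (+-identityʳ (g s₂ o₂)) ⟩
      degH p + (g s₁ (not o₁) + g s₂ o₂)       ≡⟨ cong (degH p +_) (passes u₁ u₂) ⟩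
      degH p + 2                                ∎)
    where open ≡-Reasoning

  off-path-sink : ∀ {g} → Fixed g → ∀ p → (∀ e → p ∉ path e) → inflow emb g p ≡ degH p
  off-path-sink {g} fixed p off =
    +-cancelʳ-≡ 0 _ _ (balance {g} fixed p [] [] [] (λ {_} {e} u t → ⊥-elim (off e (Used∧Touches⇒∈path u t))))

  flowOf-sink : ∀ {x} → Balanced G x → ∀ p → inflow emb (flowOf x) p ≡ degH p
  flowOf-sink {x} balanced p with Finₚ.any? (λ v → pos v ≟P p)
  ... | yes (v , refl) = proj₂ (vertex-sink⇔Balanced (flowOf-agrees x) (flowOf-fixed x) v) (balanced v)
  ... | no ¬vertex with Finₚ.any? (λ e → Membership._∈?_ _≟P_ p (interior e))
  ...   | yes (e , p∈) = interior-sink {flowOf x} (flowOf-fixed x) p∈ λ u₁ u₂ →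
            ≡-trans (cong₂ _+_ (proj₁ (flowOf-agrees x u₁)) (proj₂ (flowOf-agrees x u₂))) (headward-reverse (x e))
  ...   | no ¬interior = off-path-sink {flowOf x} (flowOf-fixed x) p off
    where
    off : ∀ e → p ∉ path e
    off e p∈ with ∈-path⁻ p∈
    ... | inj₁ p≡tl          = ¬vertex (tl e , sym p≡tl)
    ... | inj₂ (inj₁ p∈I)    = ¬interior (e , p∈I)
    ... | inj₂ (inj₂ p≡hd)   = ¬vertex (hd e , sym p≡hd)

  KindCompatible⇒KindOK : ∀ {x} → KindCompatible G x → ∀ e → KindOK emb (kind e) (headward (x e))
  KindCompatible⇒KindOK {x} compatible e with kind e | x e | compatible e
  ... | directed   | forward  | _           = s≤s z≤n
  ... | directed   | unused   | _           = s≤s z≤n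
  ... | directed   | backward | not-back , _ = ⊥-elim (not-back refl refl)
  ... | undirected | _        | _           = _
  ... | required   | forward  | _           = inj₂ refl
  ... | required   | unused   | _ , used     = ⊥-elim (used refl refl)
  ... | required   | backward | _           = inj₁ refl

  KindOK⇒compatible : ∀ k d → KindOK emb k (headward d) → (k ≡ directed → d ≢ backward) × (k ≡ required → d ≢ unused)
  KindOK⇒compatible directed   backward ()
  KindOK⇒compatible directed   forward  _ = (λ _ ()) , (λ ())
  KindOK⇒compatible directed   unused   _ = (λ _ ()) , (λ ())
  KindOK⇒compatible undirected _        _ = (λ ()) , (λ ())
  KindOK⇒compatible required   unused   (inj₁ ())
  KindOK⇒compatible required   unused   (inj₂ ())
  KindOK⇒compatible required   forward  _ = (λ ()) , (λ _ ())
  KindOK⇒compatible required   backward _ = (λ ()) , (λ _ ())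

  flowOf-isFlow : ∀ {x} → KindCompatible G x → Balanced G x → IsFlow emb (flowOf x)
  flowOf-isFlow {x} compatible balanced =
      flowOf-supply x
    , flowOf-sink balanced
    , λ s → (λ e o u → subst (KindOK emb (kind e)) (sym (proj₁ (flowOf-agrees x u))) (KindCompatible⇒KindOK compatible e))
          , flowOf-fixed x s

  module _ {f : Flow a b} (isFlow : IsFlow emb f) where

    private
      supply : ∀ s o → f s o + f s (not o) ≡ 2
      supply s false = proj₁ isFlow s
      supply s true  = ≡-trans (+-comm (f s true) (f s false)) (proj₁ isFlow s)

      sink       = proj₁ (proj₂ isFlow)
      admissible = proj₂ (proj₂ isFlow)

      fixed : Fixed f
      fixed s = proj₂ (admissible s)

      -- What an interior point receives from one segment it passes on through the next.
      pass-through : ∀ {e s₁ o₁ s₂ o₂} → Used s₁ e o₁ → Used s₂ e o₂ → end s₁ (not o₁) ≡ end s₂ o₂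
                   → f s₂ (not o₂) ≡ f s₁ (not o₁)
      pass-through {e} {s₁} {o₁} {s₂} {o₂} u₁ u₂ meet = +-cancelʳ-≡ (f s₂ o₂) _ _ (begin
        f s₂ (not o₂) + f s₂ o₂ ≡⟨ +-comm (f s₂ (not o₂)) (f s₂ o₂) ⟩
        f s₂ o₂ + f s₂ (not o₂) ≡⟨ supply s₂ o₂ ⟩
        2                        ≡⟨ received ⟩
        f s₁ (not o₁) + f s₂ o₂ ∎)
        where
        open ≡-Reasoning
        p = end s₂ o₂
        p∈interior : p ∈ interior e
        p∈interior with ∈-path⁻ (proj₁ (∈-pairs⁻ u₂))
        ... | inj₁ p≡tl       = ⊥-elim (Used⇒finish≢tail u₁ (≡-trans meet p≡tl))
        ... | inj₂ (inj₁ p∈)  = p∈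
        ... | inj₂ (inj₂ p≡hd) = ⊥-elim (Used⇒start≢head u₂ p≡hd)
        received : 2 ≡ f s₁ (not o₁) + f s₂ o₂
        received = +-cancelˡ-≡ (degH p) _ _ (begin
          degH p + 2                           ≡⟨ cong (_+ 2) (sym (sink p)) ⟩
          inflow emb f p + 2                   ≡⟨ interior-balance {f} fixed p∈interior u₁ meet u₂ refl ⟩
          degH p + (f s₁ (not o₁) + (f s₂ o₂ + 0)) ≡⟨ cong (λ n → degH p + (f s₁ (not o₁) + n)) (+-identityʳ (f s₂ o₂)) ⟩
          degH p + (f s₁ (not o₁) + f s₂ o₂)   ∎)

      carried : Fin nE → ℕ
      carried e = f (proj₁ (firstSegment e)) (not (proj₁ (proj₂ (firstSegment e))))

      carried-everywhere : ∀ {s e o} → Used s e o → f s (not o) ≡ carried e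
      carried-everywhere {s} {e} {o} u =
        pairs-propagate Q (interior e ++ pos (hd e) ∷ []) on-first step u refl
        where
        Q : Point a b × Point a b → Set
        Q pq = ∀ {s o} → endpoints s o ≡ pq → f s (not o) ≡ carried e
        first = firstSegment e
        on-first : ∀ {q} → (pos (tl e) , q) ∈ pairs (path e) → Q (pos (tl e) , q)
        on-first q∈ eq with same-start⇒same-segment (subst (_∈ pairs (path e)) (sym eq) q∈) (proj₂ (proj₂ (proj₂ first)))
                              (≡-trans (cong proj₁ eq) (sym (proj₁ (proj₂ (proj₂ first)))))
        ... | refl , refl = refl
        step : ∀ {u v w} → (u , v) ∈ pairs (path e) → (v , w) ∈ pairs (path e) → Q (u , v) → Q (v , w)
        step uv∈ vw∈ Q-uv eq with segmentOf uv∈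
        ... | s₁ , o₁ , eq₁ , u₁ =
          ≡-trans (pass-through u₁ (subst (_∈ pairs (path e)) (sym eq) vw∈) (≡-trans (cong proj₂ eq₁) (sym (cong proj₁ eq))))
                  (Q-uv eq₁)

      carried≤2 : ∀ e → carried e ≤ 2
      carried≤2 e = subst (carried e ≤_) (supply s o) (m≤n+m (carried e) (f s o))
        where
        s = proj₁ (firstSegment e)
        o = proj₁ (proj₂ (firstSegment e))

    useOf : Fin nE → EdgeUse
    useOf e = proj₁ (headward-surjective (carried≤2 e))

    useOf-agrees : Agrees f useOf
    useOf-agrees {s} {e} {o} u = towards-head , towards-tail
      where
      towards-head : f s (not o) ≡ headward (useOf e)
      towards-head = ≡-trans (carried-everywhere u) (sym (proj₂ (headward-surjective (carried≤2 e))))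
      towards-tail : f s o ≡ headward (reverse (useOf e))
      towards-tail = +-cancelʳ-≡ (f s (not o)) _ _ (begin
        f s o + f s (not o)                               ≡⟨ supply s o ⟩
        2                                                  ≡⟨ sym (headward-reverse (useOf e)) ⟩
        headward (useOf e) + headward (reverse (useOf e)) ≡⟨ +-comm (headward (useOf e)) _ ⟩
        headward (reverse (useOf e)) + headward (useOf e) ≡⟨ cong (headward (reverse (useOf e)) +_) (sym towards-head) ⟩
        headward (reverse (useOf e)) + f s (not o)        ∎)
        where open ≡-Reasoning

    useOf-kindCompatible : KindCompatible G useOf
    useOf-kindCompatible e =
      KindOK⇒compatible (kind e) (useOf e)
        (subst (KindOK emb (kind e)) (sym (proj₂ (headward-surjective (carried≤2 e))))
               (proj₁ (admissible (proj₁ first)) e (proj₁ (proj₂ first)) (proj₂ (proj₂ (proj₂ first)))))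
      where first = firstSegment e

    useOf-balanced : Balanced G useOf
    useOf-balanced v = proj₁ (vertex-sink⇔Balanced useOf-agrees fixed v) (sink (pos v))

    flowOf-useOf : ∀ s o → flowOf useOf s o ≡ f s o
    flowOf-useOf s o = sym (Agrees⇒≗flowOf useOf-agrees fixed s o)

-- Vertices of degree three

_≟ᵘ_ : DecidableEquality EdgeUse
d ≟ᵘ d′ = map′ headward-injective (cong headward) (headward d Nat.≟ headward d′)

∀-EdgeUse? : ∀ {P : EdgeUse → Set} → (∀ d → Dec (P d)) → Dec (∀ d → P d)
∀-EdgeUse? P? = map′ (λ { (pf , pu , pb) forward → pf ; (pf , pu , pb) unused → pu ; (pf , pu , pb) backward → pb })
                     (λ h → h forward , h unused , h backward)
                     (P? forward ×-dec P? unused ×-dec P? backward)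

OneOutOneIn : List EdgeUse → Set
OneOutOneIn us = ExactlyOne (_≡ backward) us × ExactlyOne (_≡ forward) us

-- Seen from a vertex, backward means leaving (value 0) and forward entering
-- (value 2). Checked on all 27 triples.
three-edge-balance : ∀ us → length us ≡ 3 → Any (_≢ unused) us
  → (sum (map headward us) ≡ 3 → OneOutOneIn us) × (OneOutOneIn us → sum (map headward us) ≡ 3)
three-edge-balance (d₁ ∷ d₂ ∷ d₃ ∷ []) refl =
  toWitness {a? = ∀-EdgeUse? λ d₁ → ∀-EdgeUse? λ d₂ → ∀-EdgeUse? λ d₃ → balance? (d₁ ∷ d₂ ∷ d₃ ∷ [])} _
            d₁ d₂ d₃
  where
  exactlyOne? : ∀ d us → Dec (ExactlyOne (_≡ d) us)
  exactlyOne? d us = Any.any? (_≟ᵘ d) us ×-dec AllPairs.allPairs? (λ x y → ¬? ((x ≟ᵘ d) ×-dec (y ≟ᵘ d))) us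
  oneOutOneIn? : ∀ us → Dec (OneOutOneIn us)
  oneOutOneIn? us = exactlyOne? backward us ×-dec exactlyOne? forward us
  balance? : ∀ us → Dec (Any (_≢ unused) us
    → (sum (map headward us) ≡ 3 → OneOutOneIn us) × (OneOutOneIn us → sum (map headward us) ≡ 3))
  balance? us = Any.any? (λ d → ¬? (d ≟ᵘ unused)) us
    →-dec (((sum (map headward us) Nat.≟ 3) →-dec oneOutOneIn? us) ×-dec (oneOutOneIn? us →-dec (sum (map headward us) Nat.≟ 3)))

module _ (G : MixedGraph) where
  open MixedGraph G

  ∈-incident⁺ : ∀ {v e} → Incident G v e → e ∈ incident G v
  ∈-incident⁺ {v} {e} = ∈-filter⁺ (incident? G v) (∈-allFin e)

  ∈-incident⁻ : ∀ {v e} → e ∈ incident G v → Incident G v e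
  ∈-incident⁻ {v} e∈ = proj₂ (∈-filter⁻ (incident? G v) {xs = allFin nE} e∈)

  degree≡length-incident : ∀ v → degree G v ≡ length (incident G v)
  degree≡length-incident v = count (allFin nE)
    where
    count : ∀ es → sum (map (λ e → ind G (tl e Fin.≟ v) + ind G (hd e Fin.≟ v)) es) ≡ length (filter (incident? G v) es)
    count []       = refl
    count (e ∷ es) with tl e Fin.≟ v | hd e Fin.≟ v
    ... | yes t | yes h = ⊥-elim (noLoop e (≡-trans t (sym h)))
    ... | yes _ | no _  = cong suc (count es)
    ... | no _  | yes _ = cong suc (count es)
    ... | no _  | no _  = count es

  required-incident : ∀ v → reqDegree G v ≡ 1 → ∃[ e ] (e ∈ incident G v × kind e ≡ required)
  required-incident v req with search (allFin nE) (λ z → 1≢0 (≡-trans (sym req) z))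
    where
    1≢0 : 1 ≢ 0
    1≢0 ()
    weight : Fin nE → ℕ
    weight e = if isRequired (kind e) then ind G (tl e Fin.≟ v) + ind G (hd e Fin.≟ v) else 0
    weighted : ∀ e → weight e ≢ 0 → Incident G v e × kind e ≡ required
    weighted e w≢0 with kind e | tl e Fin.≟ v | hd e Fin.≟ v
    ... | directed   | _     | _     = ⊥-elim (w≢0 refl)
    ... | undirected | _     | _     = ⊥-elim (w≢0 refl)
    ... | required   | yes t | _     = inj₁ t , refl
    ... | required   | no _  | yes h = inj₂ h , refl
    ... | required   | no _  | no _  = ⊥-elim (w≢0 refl)
    search : ∀ es → sum (map weight es) ≢ 0 → ∃[ e ] (e ∈ es × Incident G v e × kind e ≡ required)
    search []       nz = ⊥-elim (nz refl)
    search (e ∷ es) nz with weight e Nat.≟ 0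
    ... | no w≢0 = e , here refl , weighted e w≢0
    ... | yes w≡0 with search es (λ z → nz (≡-trans (cong (_+ sum (map weight es)) w≡0) z))
    ...   | e′ , e′∈ , found = e′ , there e′∈ , found
  ... | e , _ , inc , k = e , ∈-incident⁺ inc , k

  Leaves⇒toward-backward : ∀ {x v e} → Leaves G x v e → e ∈ incident G v × useToward G x v e ≡ backward
  Leaves⇒toward-backward {x} {v} {e} l = ∈-incident⁺ (incidence l) , toward l
    where
    incidence : Leaves G x v e → Incident G v e
    incidence (inj₁ (t , _)) = inj₁ t
    incidence (inj₂ (h , _)) = inj₂ h
    toward : Leaves G x v e → useToward G x v e ≡ backward
    toward l with tl e Fin.≟ v | l
    ... | yes _  | inj₁ (_ , xf) = cong reverse xf
    ... | yes t  | inj₂ (h , _)  = ⊥-elim (noLoop e (≡-trans t (sym h)))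
    ... | no ¬t  | inj₁ (t , _)  = ⊥-elim (¬t t)
    ... | no _   | inj₂ (_ , xb) = xb

  toward-backward⇒Leaves : ∀ {x v e} → e ∈ incident G v → useToward G x v e ≡ backward → Leaves G x v e
  toward-backward⇒Leaves {x} {v} {e} e∈ eq with tl e Fin.≟ v | ∈-incident⁻ e∈
  ... | yes t | _      = inj₁ (t , reverse-injective {x e} {forward} eq)
  ... | no ¬t | inj₁ t = ⊥-elim (¬t t)
  ... | no _  | inj₂ h = inj₂ (h , eq)

  Enters⇒toward-forward : ∀ {x v e} → Enters G x v e → e ∈ incident G v × useToward G x v e ≡ forward
  Enters⇒toward-forward {x} {v} {e} ent = ∈-incident⁺ (incidence ent) , toward ent
    where
    incidence : Enters G x v e → Incident G v e
    incidence (inj₁ (h , _)) = inj₂ h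
    incidence (inj₂ (t , _)) = inj₁ t
    toward : Enters G x v e → useToward G x v e ≡ forward
    toward ent with tl e Fin.≟ v | ent
    ... | yes t  | inj₁ (h , _)  = ⊥-elim (noLoop e (≡-trans t (sym h)))
    ... | yes _  | inj₂ (_ , xb) = cong reverse xb
    ... | no _   | inj₁ (_ , xf) = xf
    ... | no ¬t  | inj₂ (t , _)  = ⊥-elim (¬t t)

  toward-forward⇒Enters : ∀ {x v e} → e ∈ incident G v → useToward G x v e ≡ forward → Enters G x v e
  toward-forward⇒Enters {x} {v} {e} e∈ eq with tl e Fin.≟ v | ∈-incident⁻ e∈
  ... | yes t | _      = inj₂ (t , reverse-injective {x e} {backward} eq)
  ... | no ¬t | inj₁ t = ⊥-elim (¬t t)
  ... | no _  | inj₂ h = inj₁ (h , eq)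

  toward-unused : ∀ {x v e} → useToward G x v e ≡ unused → x e ≡ unused
  toward-unused {x} {v} {e} eq with tl e Fin.≟ v
  ... | yes _ = reverse-injective {x e} {unused} eq
  ... | no _  = eq

  module _ (degree≡3 : ∀ v → degree G v ≡ 3) (reqDegree≡1 : ∀ v → reqDegree G v ≡ 1) where

    private
      module AtVertex {x} (compatible : KindCompatible G x) (v : Fin nV) where
        I  = incident G v
        us = map (useToward G x v) I

        length-I : length I ≡ 3
        length-I = ≡-trans (sym (degree≡length-incident v)) (degree≡3 v)

        some-used : Any (_≢ unused) us
        some-used with required-incident v (reqDegree≡1 v)
        ... | e , e∈ , k = lose (∈-map⁺ (useToward G x v) e∈) (λ eq → proj₂ (compatible e) k (toward-unused eq))

        balance⇔ = three-edge-balance us (≡-trans (length-map _ I) length-I) some-used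

        I-unique : Unique I
        I-unique = Uniqueₚ.filter⁺ (incident? G v) (Uniqueₚ.allFin⁺ nE)

        leaving⇔ = ExactlyOne-map⇔∃! (useToward G x v) {_≡ backward} {Leaves G x v} I-unique
                     (Leaves⇒toward-backward {x}) (toward-backward⇒Leaves {x})
        entering⇔ = ExactlyOne-map⇔∃! (useToward G x v) {_≡ forward} {Enters G x v} I-unique
                      (Enters⇒toward-forward {x}) (toward-forward⇒Enters {x})

        sum-us : sum (map (headward ∘ useToward G x v) I) ≡ sum (map headward us)
        sum-us = cong sum (map-∘ I)

    IsCoverOrientation⇒Balanced : ∀ {x} → IsCoverOrientation G x → Balanced G x
    IsCoverOrientation⇒Balanced {x} ox v = begin
      sum (map (headward ∘ useToward G x v) I) ≡⟨ sum-us ⟩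
      sum (map headward us)                    ≡⟨ proj₂ balance⇔ (proj₂ leaving⇔ (leaving v) , proj₂ entering⇔ (entering v)) ⟩
      3                                        ≡⟨ sym length-I ⟩
      length I                                 ∎
      where
      open ≡-Reasoning
      open IsCoverOrientation ox
      open AtVertex kindCompatible v

    Balanced⇒IsCoverOrientation : ∀ {x} → KindCompatible G x → Balanced G x → IsCoverOrientation G x
    Balanced⇒IsCoverOrientation {x} compatible balanced = record
      { kindCompatible = compatible
      ; leaving        = λ v → let open AtVertex compatible v in proj₁ leaving⇔ (proj₁ (one-out-one-in v))
      ; entering       = λ v → let open AtVertex compatible v in proj₁ entering⇔ (proj₂ (one-out-one-in v))
      }
      where
      one-out-one-in : ∀ v → OneOutOneIn (map (useToward G x v) (incident G v))
      one-out-one-in v = proj₁ balance⇔ (≡-trans (sym sum-us) (≡-trans (balanced v) length-I))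
        where open AtVertex compatible v

mainTheorem3 : (G : MixedGraph) (a b : ℕ) (emb : GridEmbedding G a b)
    → (∀ v → degree G v ≡ 3)
    → (∀ v → reqDegree G v ≡ 1)
    → Bijection (SameCover G) (SameFlow emb)
mainTheorem3 G a b emb degree≡3 reqDegree≡1 = record
  { to         = to
  ; cong       = λ X Y X∼Y → flowOf-cong emb (orientation-cong G X Y X∼Y)
  ; injective  = λ X Y same → orientation-injective G X Y (flowOf-injective emb same)
  ; surjective = surjective
  }
  where
  to : CycleCoverR G → FlowN emb
  to (C , cover) = flowOf emb (orientation G C)
                 , flowOf-isFlow emb (IsCoverOrientation.kindCompatible ox) (IsCoverOrientation⇒Balanced G degree≡3 reqDegree≡1 ox)
    where ox = CoverSteps.isCoverOrientation G C cover

  surjective : ∀ z → ∃[ X ] SameFlow emb (to X) z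
  surjective (f , isFlow) = proj₁ realised , λ s o →
    ≡-trans (flowOf-cong emb (proj₂ realised) s o) (flowOf-useOf emb isFlow s o)
    where
    realised = cover-of-orientation G (Balanced⇒IsCoverOrientation G degree≡3 reqDegree≡1
                                         (useOf-kindCompatible emb isFlow) (useOf-balanced emb isFlow))
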